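{- For every $n\in\mathbb{N}$, the logic $\mathsf{J}_n.\mathsf{lin}$ is sound and complete for the class of finite, hereditarily linear $J_n$-frames: an $\mathcal{L}_{[<n]}$-formula $\phi$ is a theorem of $\mathsf{J}_n.\mathsf{lin}$ if and only if $\phi$ is true at every world of every finite hereditarily linear $J_n$-frame under every valuation.
   Context: $\mathcal{L}_{[<n]}$: propositional variables, $\top$ ($\bot:=\lnot\top$), Boolean connectives, modal operators $[m]$ ($m<n$) with duals $\langle m\rangle:=\lnot[m]\lnot$. $\mathsf{J}_n$: axioms are all propositional tautologies; $[k](\phi\to\psi)\to([k]\phi\to[k]\psi)$ for $k<n$; $[k]([k]\phi\to\phi)\to[k]\phi$ for $k<n$; $[k]\phi\to[k][m]\phi$ for $k\le m<n$; $[k]\phi\to[m][k]\phi$ for $k\le m<n$; $\langle k\rangle\phi\to[m]\langle k\rangle\phi$ for $k<m<n$; rules modus ponens and necessitation (from $\phi$ infer $[k]\phi$). $\mathsf{J}_n.\mathsf{lin}$ adds, for each $m<n$: $[m]\big((\bigwedge_{m\le k<n}[k]\phi)\to\psi\big)\vee[m]\big((\bigwedge_{m\le k<n}[k]\psi\wedge\psi)\to\phi\big)$. A $J_n$-frame is $(T,<_0,\dots,<_{n-1})$ with each $<_i$ irreflexive, transitive, converse well-founded, such that for $k<m<n$: (1) $x<_m y<_k z\Rightarrow x<_k z$; (2) $x<_k y<_m z\Rightarrow x<_k z$; (3) $x<_k z$ and $y<_m z\Rightarrow x<_k y$. It is hereditarily linear if any two distinct $x,y$ satisfy $x<_k y$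 or $y<_k x$ for some $k<n$. Kripke semantics: a valuation assigns subsets of $T$ to variables, $\top$ is true everywhere, Booleans are pointwise, and $w\Vdash\langle k\rangle\phi$ iff there is $v$ with $w<_k v$ and $v\Vdash\phi$. -}

module Defs where

open import Data.Nat using (ℕ)
open import Data.Fin using (Fin; _≤_; _<_; _≤?_)
open import Data.Bool using (Bool; true; false)
open import Data.List using (List; []; _∷_; map; filter; allFin)
open import Data.Fin.Base using (toℕ)
open import Data.Product using (Σ; _×_; ∃-syntax)
open import Data.Sum using (_⊎_)
open import Data.Unit using () renaming (⊤ to Unit)
open import Relation.Nullary using (¬_)
open import Relation.Binary.PropositionalEquality using (_≡_; _≢_)
open import Function using (flip)
open import Induction.WellFounded using (WellFounded)

data Fm (n : ℕ) : Set where
  var  : ℕ → Fm n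
  ⊤'   : Fm n
  ¬'_  : Fm n → Fm n
  _∧'_ : Fm n → Fm n → Fm n
  _∨'_ : Fm n → Fm n → Fm n
  _⇒_  : Fm n → Fm n → Fm n
  [_]_ : Fin n → Fm n → Fm n

infixr 4 _⇒_
infixr 5 _∨'_
infixr 6 _∧'_
infix 7 ¬'_ [_]_ ⟨_⟩_

⊥' : ∀ {n} → Fm n
⊥' = ¬' ⊤'

⟨_⟩_ : ∀ {n} → Fin n → Fm n → Fm n
⟨ m ⟩ φ = ¬' ([ m ] (¬' φ))

-- Propositional tautologies: formulas true under every classical (Boolean)
-- evaluation in which variables and boxed formulas [k]ψ are treated as atoms.

module _ {n : ℕ} (v : ℕ → Bool) (b : Fin n → Fm n → Bool) where
  open Data.Bool using (not; _∧_; _∨_)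
  beval : Fm n → Bool
  beval (var p) = v p
  beval ⊤' = true
  beval (¬' φ) = not (beval φ)
  beval (φ ∧' ψ) = beval φ ∧ beval ψ
  beval (φ ∨' ψ) = beval φ ∨ beval ψ
  beval (φ ⇒ ψ) = not (beval φ) ∨ beval ψ
  beval ([ k ] φ) = b k φ

Tautology : ∀ {n} → Fm n → Set
Tautology {n} φ = ∀ (v : ℕ → Bool) (b : Fin n → Fm n → Bool) → beval v b φ ≡ true

⋀ : ∀ {n} → List (Fm n) → Fm n
⋀ [] = ⊤'
⋀ (φ ∷ φs) = φ ∧' ⋀ φs

boxesFrom : ∀ {n} → Fin n → Fm n → Fm n
boxesFrom {n} m φ = ⋀ (map (λ k → [ k ] φ) (filter (m ≤?_) (allFin n)))

data JnLin⊢ {n : ℕ} : Fm n → Set where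
  taut   : ∀ {φ} → Tautology φ → JnLin⊢ φ
  K      : ∀ (k : Fin n) φ ψ → JnLin⊢ ([ k ] (φ ⇒ ψ) ⇒ ([ k ] φ ⇒ [ k ] ψ))
  Löb    : ∀ (k : Fin n) φ → JnLin⊢ ([ k ] ([ k ] φ ⇒ φ) ⇒ [ k ] φ)
  ax3    : ∀ (k m : Fin n) → k ≤ m → ∀ φ → JnLin⊢ ([ k ] φ ⇒ [ k ] ([ m ] φ))
  ax4    : ∀ (k m : Fin n) → k ≤ m → ∀ φ → JnLin⊢ ([ k ] φ ⇒ [ m ] ([ k ] φ))
  ax5    : ∀ (k m : Fin n) → k < m → ∀ φ → JnLin⊢ (⟨ k ⟩ φ ⇒ [ m ] (⟨ k ⟩ φ))
  lin    : ∀ (m : Fin n) φ ψ →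
           JnLin⊢ ([ m ] (boxesFrom m φ ⇒ ψ) ∨' [ m ] ((boxesFrom m ψ ∧' ψ) ⇒ φ))
  mp     : ∀ {φ ψ} → JnLin⊢ (φ ⇒ ψ) → JnLin⊢ φ → JnLin⊢ ψ
  nec    : ∀ (k : Fin n) {φ} → JnLin⊢ φ → JnLin⊢ ([ k ] φ)

-- Finite frames: carrier Fin N, relations <_k given as Boolean-valued
-- (hence decidable) relations.

Frame : ℕ → ℕ → Set
Frame n N = Fin n → Fin N → Fin N → Bool

module _ {n N : ℕ} (R : Frame n N) where

  Rel : Fin n → Fin N → Fin N → Set
  Rel k x y = R k x y ≡ true

  record IsJnFrame : Set where
    field
      irrefl  : ∀ k x → ¬ Rel k x x
      trans   : ∀ k x y z → Rel k x y → Rel k y z → Rel k x z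
      cwf     : ∀ k → WellFounded (flip (Rel k))
      cond1   : ∀ k m → k < m → ∀ x y z → Rel m x y → Rel k y z → Rel k x z
      cond2   : ∀ k m → k < m → ∀ x y z → Rel k x y → Rel m y z → Rel k x z
      cond3   : ∀ k m → k < m → ∀ x y z → Rel k x z → Rel m y z → Rel k x y

  HereditarilyLinear : Set
  HereditarilyLinear = ∀ x y → x ≢ y → ∃[ k ] (Rel k x y ⊎ Rel k y x)

  -- Kripke semantics; ⟨k⟩ is the primitive clause, [k] = ¬⟨k⟩¬.
  _⊩[_]_ : Fin N → (ℕ → Fin N → Bool) → Fm n → Set
  w ⊩[ V ] var p = V p w ≡ true
  w ⊩[ V ] ⊤' = Unit
  w ⊩[ V ] (¬' φ) = ¬ (w ⊩[ V ] φ)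
  w ⊩[ V ] (φ ∧' ψ) = (w ⊩[ V ] φ) × (w ⊩[ V ] ψ)
  w ⊩[ V ] (φ ∨' ψ) = (w ⊩[ V ] φ) ⊎ (w ⊩[ V ] ψ)
  w ⊩[ V ] (φ ⇒ ψ) = (w ⊩[ V ] φ) → (w ⊩[ V ] ψ)
  w ⊩[ V ] ([ k ] φ) = ¬ (∃[ v ] (Rel k w v × ¬ (v ⊩[ V ] φ)))

ValidFinHL : ∀ {n} → Fm n → Set
ValidFinHL {n} φ = ∀ (N : ℕ) (R : Frame n N) → IsJnFrame R → HereditarilyLinear R →
                   ∀ (V : ℕ → Fin N → Bool) (w : Fin N) → _⊩[_]_ R w V φ

module Submission where

-- Soundness is checked axiom by axiom; for ax5 and the linearity axiom,
-- hereditary linearity compares the two successors involved.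
--
-- Completeness is a finite canonical construction over the closure of φ. An
-- atom assigns truth values to the closure; a word is a path of atoms
-- A₀ →k₀ A₁ →k₁ ⋯ ending in an atom whose boxes all hold, and labelling i < j
-- with the least kₗ in between makes it a finite hereditarily linear J_n-frame
-- on which the truth lemma holds. So validity of φ gives ⊢ char A ⇒ φ for every
-- atom A that starts a word. The disjunction θ of the remaining atoms is
-- refuted inside J_n.lin: such an atom, with k the largest label of a box it
-- refutes, proves ⟨k⟩θ (the linearity axiom merges the successors it needs into
-- one), and Löb's axiom, applied to the modalities from the lowest upwards,
-- turns ⊢ θ ⇒ ⋁ₖ ⟨k⟩θ into ⊢ ¬θ.

open import Defs
open import Data.Bool using (Bool; true; false; not; _∧_; _∨_; T; if_then_else_)
import Data.Bool.Properties as Bool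
open import Data.Bool.Properties using (T-≡; T-not-≡; T-∧; T-∨; ¬-not)
open import Data.Bool.ListAction using (all)
open import Data.Empty using (⊥-elim) renaming (⊥ to Empty)
open import Data.Fin as Fin using (Fin; zero; suc; toℕ; fromℕ<)
import Data.Fin.Induction as Fin
import Data.Fin.Properties as Fin
open import Data.List using (List; []; _∷_; _++_; map; filter; allFin; length; cartesianProductWith)
open import Data.List.Membership.Propositional using (_∈_; find; lose)
open import Data.List.Membership.Propositional.Properties
  using (∈-map⁺; ∈-map⁻; ∈-filter⁺; ∈-filter⁻; ∈-allFin; ∈-++⁺ˡ; ∈-++⁺ʳ; ∈-++⁻; ∈-cartesianProductWith⁺)
open import Data.List.Properties using (length-filter)
open import Data.List.Relation.Unary.All as All using (All)
open import Data.List.Relation.Unary.All.Properties using (all⁺; ¬All⇒Any¬)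
open import Data.List.Relation.Unary.Any as Any using (Any; here; there)
open import Data.Nat as ℕ using (ℕ; zero; suc; z≤n; s≤s; _+_; _⊓_)
import Data.Nat.Properties as ℕ
open import Data.Product using (_×_; _,_; proj₁; proj₂; ∃-syntax)
open import Data.Product.Function.NonDependent.Propositional using (_×-⇔_)
open import Data.Sum using (_⊎_; inj₁; inj₂)
open import Data.Sum.Function.Propositional using (_⊎-⇔_)
open import Data.Unit using (tt) renaming (⊤ to Unit)
open import Data.Vec as Vec using (Vec; []; _∷_; lookup)
open import Data.Vec.Properties using (lookup-map)
open import Function using (_∘_; flip; Equivalence; _⇔_; mk⇔)
open import Function.Construct.Identity using (⇔-id)
open import Function.Related.TypeIsomorphisms using (→-cong-⇔; ¬-cong-⇔)
open import Induction.WellFounded using (Acc; acc; module Subrelation)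
open import Relation.Binary.Definitions using (DecidableEquality; tri<; tri≈; tri>)
open import Relation.Binary.PropositionalEquality using (_≡_; _≢_; refl; sym; trans; cong; cong₂; subst)
open import Relation.Nullary using (¬_; Dec; yes; no; does; contradiction)
open import Relation.Nullary.Decidable using (map′; T?; ¬?; _×-dec_; _⊎-dec_; _→-dec_; decidable-stable)
open import Relation.Unary using (Decidable)

infix 2 ⊢_

⊢_ : ∀ {n} → Fm n → Set
⊢_ = JnLin⊢

data Schema (m : ℕ) : Set where
  ‵_         : Fin m → Schema m
  ‵⊤         : Schema m
  ‵¬_        : Schema m → Schema m
  _‵∧_ _‵∨_ _‵⇒_ : Schema m → Schema m → Schema m

infixr 4 _‵⇒_
infixr 5 _‵∨_
infixr 6 _‵∧_
infix 7 ‵¬_ ‵_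

x₀ : ∀ {m} → Schema (1 + m)
x₀ = ‵ zero
x₁ : ∀ {m} → Schema (2 + m)
x₁ = ‵ suc zero
x₂ : ∀ {m} → Schema (3 + m)
x₂ = ‵ suc (suc zero)
x₃ : ∀ {m} → Schema (4 + m)
x₃ = ‵ suc (suc (suc zero))
x₄ : ∀ {m} → Schema (5 + m)
x₄ = ‵ suc (suc (suc (suc zero)))

evalˢ : ∀ {m} → Vec Bool m → Schema m → Bool
evalˢ ρ (‵ i) = lookup ρ i
evalˢ ρ ‵⊤ = true
evalˢ ρ (‵¬ S) = not (evalˢ ρ S)
evalˢ ρ (S ‵∧ S′) = evalˢ ρ S ∧ evalˢ ρ S′
evalˢ ρ (S ‵∨ S′) = evalˢ ρ S ∨ evalˢ ρ S′
evalˢ ρ (S ‵⇒ S′) = not (evalˢ ρ S) ∨ evalˢ ρ S′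

vecs : (m : ℕ) → List (Vec Bool m)
vecs zero = [] ∷ []
vecs (suc m) = cartesianProductWith _∷_ (true ∷ false ∷ []) (vecs m)

∈-vecs : ∀ {m} (ρ : Vec Bool m) → ρ ∈ vecs m
∈-vecs [] = here refl
∈-vecs (true ∷ ρ) = ∈-cartesianProductWith⁺ _∷_ {xs = true ∷ false ∷ []} (here refl) (∈-vecs ρ)
∈-vecs (false ∷ ρ) = ∈-cartesianProductWith⁺ _∷_ {xs = true ∷ false ∷ []} (there (here refl)) (∈-vecs ρ)

Valid : ∀ {m} → Schema m → Set
Valid {m} S = T (all (λ ρ → evalˢ ρ S) (vecs m))

valid-eval : ∀ {m} (S : Schema m) → Valid S → ∀ ρ → evalˢ ρ S ≡ true
valid-eval {m} S valid ρ = Equivalence.to T-≡ (All.lookup (all⁺ _ (vecs m) valid) (∈-vecs ρ))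

module _ {n : ℕ} where

  _⟨_⟩ˢ : ∀ {m} → Schema m → Vec (Fm n) m → Fm n
  (‵ i) ⟨ σ ⟩ˢ = lookup σ i
  ‵⊤ ⟨ σ ⟩ˢ = ⊤'
  (‵¬ S) ⟨ σ ⟩ˢ = ¬' S ⟨ σ ⟩ˢ
  (S ‵∧ S′) ⟨ σ ⟩ˢ = S ⟨ σ ⟩ˢ ∧' S′ ⟨ σ ⟩ˢ
  (S ‵∨ S′) ⟨ σ ⟩ˢ = S ⟨ σ ⟩ˢ ∨' S′ ⟨ σ ⟩ˢ
  (S ‵⇒ S′) ⟨ σ ⟩ˢ = S ⟨ σ ⟩ˢ ⇒ S′ ⟨ σ ⟩ˢ

  beval-⟨⟩ˢ : ∀ {m} v b (σ : Vec (Fm n) m) S → beval v b (S ⟨ σ ⟩ˢ) ≡ evalˢ (Vec.map (beval v b) σ) S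
  beval-⟨⟩ˢ v b σ (‵ i) = sym (lookup-map i (beval v b) σ)
  beval-⟨⟩ˢ v b σ ‵⊤ = refl
  beval-⟨⟩ˢ v b σ (‵¬ S) = cong not (beval-⟨⟩ˢ v b σ S)
  beval-⟨⟩ˢ v b σ (S ‵∧ S′) = cong₂ _∧_ (beval-⟨⟩ˢ v b σ S) (beval-⟨⟩ˢ v b σ S′)
  beval-⟨⟩ˢ v b σ (S ‵∨ S′) = cong₂ _∨_ (beval-⟨⟩ˢ v b σ S) (beval-⟨⟩ˢ v b σ S′)
  beval-⟨⟩ˢ v b σ (S ‵⇒ S′) = cong₂ (λ x y → not x ∨ y) (beval-⟨⟩ˢ v b σ S) (beval-⟨⟩ˢ v b σ S′)

  -- The implicit validity proof is found by Agda evaluating the truth table of S.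
  taut-instance : ∀ {m} (S : Schema m) {valid : Valid S} (σ : Vec (Fm n) m) → ⊢ S ⟨ σ ⟩ˢ
  taut-instance S {valid} σ = taut λ v b →
    trans (beval-⟨⟩ˢ v b σ S) (valid-eval S valid (Vec.map (beval v b) σ))

  ⊢-taut : ∀ {a : Fm n} → (∀ v b → T (beval v b a)) → ⊢ a
  ⊢-taut h = taut λ v b → Equivalence.to T-≡ (h v b)

  ⇒-taut : ∀ {a c : Fm n} → (∀ v b → T (beval v b a) → T (beval v b c)) → ⊢ a ⇒ c
  ⇒-taut {a} {c} h = ⊢-taut λ v b → imp (beval v b a) (h v b)
    where
    imp : ∀ x {y} → (T x → T y) → T (not x ∨ y)
    imp false _ = tt
    imp true f = f tt

module _ {n : ℕ} where

  infixr 9 _⨾_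

  ⇒-refl : (a : Fm n) → ⊢ a ⇒ a
  ⇒-refl a = taut-instance (x₀ ‵⇒ x₀) (a ∷ [])

  _⨾_ : {a b c : Fm n} → ⊢ a ⇒ b → ⊢ b ⇒ c → ⊢ a ⇒ c
  _⨾_ {a} {b} {c} p q =
    mp (mp (taut-instance ((x₀ ‵⇒ x₁) ‵⇒ (x₁ ‵⇒ x₂) ‵⇒ (x₀ ‵⇒ x₂)) (a ∷ b ∷ c ∷ [])) p) q

  ⇒-weaken : {x a : Fm n} → ⊢ a → ⊢ x ⇒ a
  ⇒-weaken {x} {a} p = mp (taut-instance (x₁ ‵⇒ x₀ ‵⇒ x₁) (x ∷ a ∷ [])) p

  ⊢⊤ : ⊢ ⊤' {n}
  ⊢⊤ = taut-instance ‵⊤ []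

  ex-falso : (a : Fm n) → ⊢ ⊥' ⇒ a
  ex-falso a = taut-instance (‵¬ ‵⊤ ‵⇒ x₀) (a ∷ [])

  contrapose : {a b : Fm n} → ⊢ a ⇒ b → ⊢ ¬' b ⇒ ¬' a
  contrapose {a} {b} p = mp (taut-instance ((x₀ ‵⇒ x₁) ‵⇒ (‵¬ x₁ ‵⇒ ‵¬ x₀)) (a ∷ b ∷ [])) p

  ∧-intro : {x a b : Fm n} → ⊢ x ⇒ a → ⊢ x ⇒ b → ⊢ x ⇒ a ∧' b
  ∧-intro {x} {a} {b} p q =
    mp (mp (taut-instance ((x₀ ‵⇒ x₁) ‵⇒ (x₀ ‵⇒ x₂) ‵⇒ (x₀ ‵⇒ x₁ ‵∧ x₂)) (x ∷ a ∷ b ∷ [])) p) q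

  ∧-elimˡ : (a b : Fm n) → ⊢ a ∧' b ⇒ a
  ∧-elimˡ a b = taut-instance (x₀ ‵∧ x₁ ‵⇒ x₀) (a ∷ b ∷ [])

  ∧-elimʳ : (a b : Fm n) → ⊢ a ∧' b ⇒ b
  ∧-elimʳ a b = taut-instance (x₀ ‵∧ x₁ ‵⇒ x₁) (a ∷ b ∷ [])

  ∨-introˡ : (a b : Fm n) → ⊢ a ⇒ a ∨' b
  ∨-introˡ a b = taut-instance (x₀ ‵⇒ x₀ ‵∨ x₁) (a ∷ b ∷ [])

  ∨-introʳ : (a b : Fm n) → ⊢ b ⇒ a ∨' b
  ∨-introʳ a b = taut-instance (x₁ ‵⇒ x₀ ‵∨ x₁) (a ∷ b ∷ [])

  ∨-elim : {a b c : Fm n} → ⊢ a ⇒ c → ⊢ b ⇒ c → ⊢ a ∨' b ⇒ c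
  ∨-elim {a} {b} {c} p q =
    mp (mp (taut-instance ((x₀ ‵⇒ x₂) ‵⇒ (x₁ ‵⇒ x₂) ‵⇒ (x₀ ‵∨ x₁ ‵⇒ x₂)) (a ∷ b ∷ c ∷ [])) p) q

  ⇒-clash : {a b x y : Fm n} → ⊢ a ⇒ x → ⊢ b ⇒ y → ⊢ x ⇒ ¬' y → ⊢ a ∧' b ⇒ ⊥'
  ⇒-clash {a} {b} {x} {y} p q r =
    mp (mp (mp (taut-instance ((x₀ ‵⇒ x₂) ‵⇒ (x₁ ‵⇒ x₃) ‵⇒ (x₂ ‵⇒ ‵¬ x₃) ‵⇒ (x₀ ‵∧ x₁ ‵⇒ ‵¬ ‵⊤))
                              (a ∷ b ∷ x ∷ y ∷ [])) p) q) r

  ⋁ : List (Fm n) → Fm n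
  ⋁ [] = ⊥'
  ⋁ (a ∷ as) = a ∨' ⋁ as

  ⋀-elim : ∀ {a} (as : List (Fm n)) → a ∈ as → ⊢ ⋀ as ⇒ a
  ⋀-elim (a ∷ as) (here refl) = ∧-elimˡ a (⋀ as)
  ⋀-elim (b ∷ as) (there a∈as) = ∧-elimʳ b (⋀ as) ⨾ ⋀-elim as a∈as

  ⋀-intro : ∀ {x} (as : List (Fm n)) → (∀ {a} → a ∈ as → ⊢ x ⇒ a) → ⊢ x ⇒ ⋀ as
  ⋀-intro [] h = ⇒-weaken ⊢⊤
  ⋀-intro (a ∷ as) h = ∧-intro (h (here refl)) (⋀-intro as (h ∘ there))

  ⋁-intro : ∀ {a} (as : List (Fm n)) → a ∈ as → ⊢ a ⇒ ⋁ as
  ⋁-intro (a ∷ as) (here refl) = ∨-introˡ a (⋁ as)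
  ⋁-intro (b ∷ as) (there a∈as) = ⋁-intro as a∈as ⨾ ∨-introʳ b (⋁ as)

  ⋁-elim : ∀ {c} (as : List (Fm n)) → (∀ {a} → a ∈ as → ⊢ a ⇒ c) → ⊢ ⋁ as ⇒ c
  ⋁-elim [] h = ex-falso _
  ⋁-elim (a ∷ as) h = ∨-elim (h (here refl)) (⋁-elim as (h ∘ there))

  ⋁-elim-∧ : ∀ {x c} (as : List (Fm n)) → (∀ {a} → a ∈ as → ⊢ x ∧' a ⇒ c) → ⊢ x ∧' ⋁ as ⇒ c
  ⋁-elim-∧ {x} {c} [] h = taut-instance (x₀ ‵∧ ‵¬ ‵⊤ ‵⇒ x₁) (x ∷ c ∷ [])
  ⋁-elim-∧ {x} {c} (a ∷ as) h =
    mp (mp (taut-instance ((x₀ ‵∧ x₁ ‵⇒ x₃) ‵⇒ (x₀ ‵∧ x₂ ‵⇒ x₃) ‵⇒ (x₀ ‵∧ (x₁ ‵∨ x₂) ‵⇒ x₃))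
                          (x ∷ a ∷ ⋁ as ∷ c ∷ []))
           (h (here refl)))
       (⋁-elim-∧ as (h ∘ there))

  □-mono : ∀ (k : Fin n) {a b} → ⊢ a ⇒ b → ⊢ [ k ] a ⇒ [ k ] b
  □-mono k {a} {b} p = mp (K k a b) (nec k p)

  □-∧ : ∀ (k : Fin n) a b → ⊢ [ k ] a ∧' [ k ] b ⇒ [ k ] (a ∧' b)
  □-∧ k a b =
    mp (mp (taut-instance ((x₀ ‵⇒ x₂) ‵⇒ (x₂ ‵⇒ x₁ ‵⇒ x₃) ‵⇒ (x₀ ‵∧ x₁ ‵⇒ x₃))
              ([ k ] a ∷ [ k ] b ∷ [ k ] (b ⇒ a ∧' b) ∷ [ k ] (a ∧' b) ∷ []))
           (□-mono k (taut-instance (x₀ ‵⇒ x₁ ‵⇒ x₀ ‵∧ x₁) (a ∷ b ∷ []))))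
       (K k b (a ∧' b))

  □-∧-intro : ∀ (k : Fin n) {x a b} → ⊢ x ⇒ [ k ] a → ⊢ x ⇒ [ k ] b → ⊢ x ⇒ [ k ] (a ∧' b)
  □-∧-intro k p q = ∧-intro p q ⨾ □-∧ k _ _

  □-⋀-intro : ∀ (k : Fin n) {x} (as : List (Fm n)) → (∀ {a} → a ∈ as → ⊢ x ⇒ [ k ] a) → ⊢ x ⇒ [ k ] (⋀ as)
  □-⋀-intro k [] h = ⇒-weaken (nec k ⊢⊤)
  □-⋀-intro k (a ∷ as) h = □-∧-intro k (h (here refl)) (□-⋀-intro k as (h ∘ there))

  ◇-mono : ∀ (k : Fin n) {a b} → ⊢ a ⇒ b → ⊢ ⟨ k ⟩ a ⇒ ⟨ k ⟩ b
  ◇-mono k p = contrapose (□-mono k (contrapose p))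

  ◇-□-mp : ∀ (k : Fin n) a b → ⊢ ⟨ k ⟩ a ∧' [ k ] (a ⇒ b) ⇒ ⟨ k ⟩ b
  ◇-□-mp k a b =
    mp (mp (taut-instance ((x₀ ‵⇒ x₁) ‵⇒ (x₁ ‵⇒ x₂ ‵⇒ x₃) ‵⇒ (‵¬ x₃ ‵∧ x₀ ‵⇒ ‵¬ x₂))
              ([ k ] (a ⇒ b) ∷ [ k ] (¬' b ⇒ ¬' a) ∷ [ k ] (¬' b) ∷ [ k ] (¬' a) ∷ []))
           (□-mono k (taut-instance ((x₀ ‵⇒ x₁) ‵⇒ (‵¬ x₁ ‵⇒ ‵¬ x₀)) (a ∷ b ∷ []))))
       (K k (¬' b) (¬' a))

  ◇-mp : ∀ (k : Fin n) {x a b} → ⊢ x ⇒ [ k ] (a ⇒ b) → ⊢ ⟨ k ⟩ a ∧' x ⇒ ⟨ k ⟩ b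
  ◇-mp k {x} {a} {b} h = ∧-intro (∧-elimˡ _ _) (∧-elimʳ _ _ ⨾ h) ⨾ ◇-□-mp k a b

  ◇-∧-□ : ∀ (k : Fin n) a b → ⊢ ⟨ k ⟩ a ∧' [ k ] b ⇒ ⟨ k ⟩ (a ∧' b)
  ◇-∧-□ k a b = ◇-mp k (□-mono k (taut-instance (x₁ ‵⇒ x₀ ‵⇒ x₀ ‵∧ x₁) (a ∷ b ∷ [])))

module _ {n : ℕ} where

  boxList : Fin n → Fm n → List (Fm n)
  boxList k γ = map (λ j → [ j ] γ) (filter (k Fin.≤?_) (allFin n))

  ∈-boxList⁺ : ∀ {k j : Fin n} {γ} → k Fin.≤ j → [ j ] γ ∈ boxList k γ
  ∈-boxList⁺ {k} {j} {γ} k≤j = ∈-map⁺ (λ i → [ i ] γ) (∈-filter⁺ (k Fin.≤?_) (∈-allFin j) k≤j)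

  ∈-boxList⁻ : ∀ {k : Fin n} {γ a} → a ∈ boxList k γ → ∃[ j ] (k Fin.≤ j × a ≡ [ j ] γ)
  ∈-boxList⁻ {k} {γ} a∈ with ∈-map⁻ (λ i → [ i ] γ) a∈
  ... | j , j∈ , refl = j , proj₂ (∈-filter⁻ (k Fin.≤?_) {xs = allFin n} j∈) , refl

  boxesFrom-elim : ∀ {k j : Fin n} γ → k Fin.≤ j → ⊢ boxesFrom k γ ⇒ [ j ] γ
  boxesFrom-elim γ k≤j = ⋀-elim _ (∈-boxList⁺ k≤j)

  boxesFrom-intro : ∀ (k : Fin n) {x γ} → (∀ j → k Fin.≤ j → ⊢ x ⇒ [ j ] γ) → ⊢ x ⇒ boxesFrom k γ
  boxesFrom-intro k {x} {γ} h = ⋀-intro (boxList k γ) each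
    where
    each : ∀ {a} → a ∈ boxList k γ → ⊢ x ⇒ a
    each a∈ with ∈-boxList⁻ a∈
    ... | j , k≤j , refl = h j k≤j

  boxesFrom-□ : ∀ {k j : Fin n} γ → k Fin.≤ j → ⊢ boxesFrom k γ ⇒ [ j ] boxesFrom k γ
  boxesFrom-□ {k} {j} γ k≤j = □-⋀-intro j (boxList k γ) each
    where
    each : ∀ {a} → a ∈ boxList k γ → ⊢ boxesFrom k γ ⇒ [ j ] a
    each a∈ with ∈-boxList⁻ a∈
    ... | i , k≤i , refl with Fin.≤-total j i
    ... | inj₁ j≤i = boxesFrom-elim γ k≤j ⨾ ax3 j i j≤i γ
    ... | inj₂ i≤j = boxesFrom-elim γ k≤i ⨾ ax4 i j i≤j γ

  Persistent : Fin n → Fm n → Set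
  Persistent k γ = ⊢ γ ⇒ boxesFrom k γ

  persistent-⊥ : ∀ k → Persistent k ⊥'
  persistent-⊥ k = ex-falso _

  persistent-∨ : ∀ k {a b} → Persistent k a → Persistent k b → Persistent k (a ∨' b)
  persistent-∨ k {a} {b} pa pb = boxesFrom-intro k λ j k≤j →
    ∨-elim (pa ⨾ boxesFrom-elim a k≤j ⨾ □-mono j (∨-introˡ a b))
           (pb ⨾ boxesFrom-elim b k≤j ⨾ □-mono j (∨-introʳ a b))

  persistent-∧boxesFrom : ∀ k ψ → Persistent k (ψ ∧' boxesFrom k ψ)
  persistent-∧boxesFrom k ψ = boxesFrom-intro k λ j k≤j →
    ∧-elimʳ ψ _ ⨾ □-∧-intro j (boxesFrom-elim ψ k≤j) (boxesFrom-□ ψ k≤j)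

  □⇒□∧boxesFrom : ∀ (k : Fin n) ψ → ⊢ [ k ] ψ ⇒ [ k ] (ψ ∧' boxesFrom k ψ)
  □⇒□∧boxesFrom k ψ = □-∧-intro k (⇒-refl _) (□-⋀-intro k (boxList k ψ) each)
    where
    each : ∀ {a} → a ∈ boxList k ψ → ⊢ [ k ] ψ ⇒ [ k ] a
    each a∈ with ∈-boxList⁻ a∈
    ... | j , k≤j , refl = ax3 k j k≤j ψ

  ¬□⇒◇¬ : ∀ (m : Fin n) ψ → ⊢ ¬' [ m ] ψ ⇒ ⟨ m ⟩ (¬' ψ)
  ¬□⇒◇¬ m ψ = contrapose (□-mono m (taut-instance (‵¬ ‵¬ x₀ ‵⇒ x₀) (ψ ∷ [])))

  ◇¬⇒¬□ : ∀ (m : Fin n) ψ → ⊢ ⟨ m ⟩ (¬' ψ) ⇒ ¬' [ m ] ψ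
  ◇¬⇒¬□ m ψ = contrapose (□-mono m (taut-instance (x₀ ‵⇒ ‵¬ ‵¬ x₀) (ψ ∷ [])))

  -- The linearity axiom, read through persistence: a k-successor refuting α
  -- and one refuting β can be merged into one refuting both.
  ◇¬-merge : ∀ (k : Fin n) {α β} → Persistent k α → Persistent k β →
             ⊢ ⟨ k ⟩ (¬' α) ∧' ⟨ k ⟩ (¬' β) ⇒ ⟨ k ⟩ (¬' (α ∨' β))
  ◇¬-merge k {α} {β} pα pβ =
    mp (mp (mp (taut-instance ((x₀ ‵∨ x₁) ‵⇒ (x₃ ‵∧ x₀ ‵⇒ x₄) ‵⇒ (x₂ ‵∧ x₁ ‵⇒ x₄) ‵⇒ (x₂ ‵∧ x₃ ‵⇒ x₄))
                  ([ k ] (boxesFrom k α ⇒ β) ∷ [ k ] ((boxesFrom k β ∧' β) ⇒ α)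
                    ∷ ⟨ k ⟩ (¬' α) ∷ ⟨ k ⟩ (¬' β) ∷ ⟨ k ⟩ (¬' (α ∨' β)) ∷ []))
               (lin k α β))
           (◇-mp k (□-mono k (mp (taut-instance ((x₀ ‵⇒ x₁) ‵⇒ (x₁ ‵⇒ x₂) ‵⇒ (‵¬ x₂ ‵⇒ ‵¬ (x₀ ‵∨ x₂)))
                                   (α ∷ boxesFrom k α ∷ β ∷ [])) pα))))
       (◇-mp k (□-mono k (mp (taut-instance ((x₀ ‵⇒ x₁) ‵⇒ (x₁ ‵∧ x₀ ‵⇒ x₂) ‵⇒ (‵¬ x₂ ‵⇒ ‵¬ (x₂ ‵∨ x₀)))
                               (β ∷ boxesFrom k β ∷ α ∷ [])) pβ)))

  diamondList : ℕ → Fm n → List (Fm n)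
  diamondList a θ = map (λ k → ⟨ k ⟩ θ) (filter (λ k → a ℕ.≤? toℕ k) (allFin n))

  diamondsFrom : ℕ → Fm n → Fm n
  diamondsFrom a θ = ⋁ (diamondList a θ)

  ∈-diamondList⁻ : ∀ {a θ e} → e ∈ diamondList a θ → ∃[ k ] (a ℕ.≤ toℕ k × e ≡ ⟨ k ⟩ θ)
  ∈-diamondList⁻ {a} {θ} e∈ with ∈-map⁻ (λ k → ⟨ k ⟩ θ) e∈
  ... | k , k∈ , refl = k , proj₂ (∈-filter⁻ (λ k → a ℕ.≤? toℕ k) {xs = allFin n} k∈) , refl

  diamondsFrom-intro : ∀ {a θ} (k : Fin n) → a ℕ.≤ toℕ k → ⊢ ⟨ k ⟩ θ ⇒ diamondsFrom a θ
  diamondsFrom-intro {a} {θ} k a≤k =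
    ⋁-intro _ (∈-map⁺ (λ k → ⟨ k ⟩ θ) (∈-filter⁺ (λ k → a ℕ.≤? toℕ k) (∈-allFin k) a≤k))

  ⇒⊥-¬ : {θ : Fm n} → ⊢ θ ⇒ ⊥' → ⊢ ¬' θ
  ⇒⊥-¬ {θ} h = mp (taut-instance ((x₀ ‵⇒ ‵¬ ‵⊤) ‵⇒ ‵¬ x₀) (θ ∷ [])) h

  -- Löb's rule for the lowest modality a₀ in play removes it:
  -- θ ∧ [a₀]¬θ only has successors through modalities above a₀.
  löb-diamondsFrom : ∀ d a → d + a ≡ n → ∀ θ → ⊢ θ ⇒ diamondsFrom a θ → ⊢ ¬' θ
  löb-diamondsFrom zero a refl θ h = ⇒⊥-¬ (h ⨾ ⋁-elim _ none)
    where
    none : ∀ {e} → e ∈ diamondList n θ → ⊢ e ⇒ ⊥'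
    none e∈ with ∈-diamondList⁻ e∈
    ... | k , n≤k , refl = ⊥-elim (ℕ.<⇒≱ (Fin.toℕ<n k) n≤k)
  löb-diamondsFrom (suc d) a d+a≡n θ h = mp ([a₀]¬θ⇒¬θ) (mp (Löb a₀ (¬' θ)) (nec a₀ [a₀]¬θ⇒¬θ))
    where
    a<n : a ℕ.< n
    a<n = subst (a ℕ.<_) d+a≡n (ℕ.m<n+m a (s≤s z≤n))
    a₀ : Fin n
    a₀ = fromℕ< a<n
    θ′ : Fm n
    θ′ = θ ∧' [ a₀ ] (¬' θ)
    step : ∀ {e} → e ∈ diamondList a θ → ⊢ [ a₀ ] (¬' θ) ∧' e ⇒ diamondsFrom (suc a) θ′
    step e∈ with ∈-diamondList⁻ e∈
    ... | k , a≤k , refl with a ℕ.<? toℕ k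
    ... | yes a<k =
      taut-instance (x₀ ‵∧ x₁ ‵⇒ x₁ ‵∧ x₀) ([ a₀ ] (¬' θ) ∷ ⟨ k ⟩ θ ∷ [])
      ⨾ ∧-intro (∧-elimˡ _ _) (∧-elimʳ _ _ ⨾ ax4 a₀ k a₀≤k (¬' θ))
      ⨾ ◇-∧-□ k θ ([ a₀ ] (¬' θ))
      ⨾ diamondsFrom-intro k a<k
      where
      a₀≤k : a₀ Fin.≤ k
      a₀≤k = subst (ℕ._≤ toℕ k) (sym (Fin.toℕ-fromℕ< a<n)) a≤k
    ... | no a≮k = subst (λ k → ⊢ [ a₀ ] (¬' θ) ∧' ⟨ k ⟩ θ ⇒ diamondsFrom (suc a) θ′) a₀≡k
                     (taut-instance (x₀ ‵∧ ‵¬ x₀ ‵⇒ x₁) ([ a₀ ] (¬' θ) ∷ diamondsFrom (suc a) θ′ ∷ []))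
      where
      a₀≡k : a₀ ≡ k
      a₀≡k = Fin.toℕ-injective (trans (Fin.toℕ-fromℕ< a<n) (ℕ.≤-antisym a≤k (ℕ.≮⇒≥ a≮k)))
    ¬θ′ : ⊢ ¬' θ′
    ¬θ′ = löb-diamondsFrom d (suc a) (trans (ℕ.+-suc d a) d+a≡n) θ′
            (∧-intro (∧-elimʳ θ _) (∧-elimˡ θ _ ⨾ h) ⨾ ⋁-elim-∧ _ step)
    [a₀]¬θ⇒¬θ : ⊢ [ a₀ ] (¬' θ) ⇒ ¬' θ
    [a₀]¬θ⇒¬θ = mp (taut-instance (‵¬ (x₀ ‵∧ x₁) ‵⇒ x₁ ‵⇒ ‵¬ x₀) (θ ∷ [ a₀ ] (¬' θ) ∷ [])) ¬θ′

  löb-◇ : ∀ θ → ⊢ θ ⇒ diamondsFrom 0 θ → ⊢ ¬' θ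
  löb-◇ = löb-diamondsFrom n 0 (ℕ.+-identityʳ n)

module _ {n : ℕ} where

  infix 4 _≡ᵇ_ _≟_

  _≡ᵇ_ : Fm n → Fm n → Bool
  var p ≡ᵇ var q = p ℕ.≡ᵇ q
  ⊤' ≡ᵇ ⊤' = true
  (¬' a) ≡ᵇ (¬' b) = a ≡ᵇ b
  (a ∧' b) ≡ᵇ (c ∧' d) = (a ≡ᵇ c) ∧ (b ≡ᵇ d)
  (a ∨' b) ≡ᵇ (c ∨' d) = (a ≡ᵇ c) ∧ (b ≡ᵇ d)
  (a ⇒ b) ≡ᵇ (c ⇒ d) = (a ≡ᵇ c) ∧ (b ≡ᵇ d)
  ([ k ] a) ≡ᵇ ([ j ] b) = (toℕ k ℕ.≡ᵇ toℕ j) ∧ (a ≡ᵇ b)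
  _ ≡ᵇ _ = false

  ≡ᵇ-refl : ∀ a → T (a ≡ᵇ a)
  ≡ᵇ-refl (var p) = ℕ.≡⇒≡ᵇ p p refl
  ≡ᵇ-refl ⊤' = tt
  ≡ᵇ-refl (¬' a) = ≡ᵇ-refl a
  ≡ᵇ-refl (a ∧' b) = Equivalence.from T-∧ (≡ᵇ-refl a , ≡ᵇ-refl b)
  ≡ᵇ-refl (a ∨' b) = Equivalence.from T-∧ (≡ᵇ-refl a , ≡ᵇ-refl b)
  ≡ᵇ-refl (a ⇒ b) = Equivalence.from T-∧ (≡ᵇ-refl a , ≡ᵇ-refl b)
  ≡ᵇ-refl ([ k ] a) = Equivalence.from T-∧ (ℕ.≡⇒≡ᵇ (toℕ k) (toℕ k) refl , ≡ᵇ-refl a)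

  ≡ᵇ⇒≡ : ∀ a b → T (a ≡ᵇ b) → a ≡ b
  ≡ᵇ⇒≡ (var p) (var q) e = cong var (ℕ.≡ᵇ⇒≡ p q e)
  ≡ᵇ⇒≡ ⊤' ⊤' e = refl
  ≡ᵇ⇒≡ (¬' a) (¬' b) e = cong ¬'_ (≡ᵇ⇒≡ a b e)
  ≡ᵇ⇒≡ (a ∧' b) (c ∧' d) e = let e₁ , e₂ = Equivalence.to T-∧ e in cong₂ _∧'_ (≡ᵇ⇒≡ a c e₁) (≡ᵇ⇒≡ b d e₂)
  ≡ᵇ⇒≡ (a ∨' b) (c ∨' d) e = let e₁ , e₂ = Equivalence.to T-∧ e in cong₂ _∨'_ (≡ᵇ⇒≡ a c e₁) (≡ᵇ⇒≡ b d e₂)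
  ≡ᵇ⇒≡ (a ⇒ b) (c ⇒ d) e = let e₁ , e₂ = Equivalence.to T-∧ e in cong₂ _⇒_ (≡ᵇ⇒≡ a c e₁) (≡ᵇ⇒≡ b d e₂)
  ≡ᵇ⇒≡ ([ k ] a) ([ j ] b) e = let e₁ , e₂ = Equivalence.to T-∧ e in
    cong₂ [_]_ (Fin.toℕ-injective (ℕ.≡ᵇ⇒≡ (toℕ k) (toℕ j) e₁)) (≡ᵇ⇒≡ a b e₂)

  _≟_ : DecidableEquality (Fm n)
  a ≟ b = map′ (≡ᵇ⇒≡ a b) (λ { refl → ≡ᵇ-refl a }) (T? (a ≡ᵇ b))

  Over : List (Fm n) → Fm n → Set
  Over P (var p) = var p ∈ P
  Over P ⊤' = Unit
  Over P (¬' a) = Over P a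
  Over P (a ∧' b) = Over P a × Over P b
  Over P (a ∨' b) = Over P a × Over P b
  Over P (a ⇒ b) = Over P a × Over P b
  Over P ([ k ] a) = [ k ] a ∈ P

  Over-mono : ∀ {P Q} → (∀ {a} → a ∈ P → a ∈ Q) → ∀ χ → Over P χ → Over Q χ
  Over-mono P⊆Q (var p) h = P⊆Q h
  Over-mono P⊆Q ⊤' h = tt
  Over-mono P⊆Q (¬' χ) h = Over-mono P⊆Q χ h
  Over-mono P⊆Q (a ∧' b) (h , h′) = Over-mono P⊆Q a h , Over-mono P⊆Q b h′
  Over-mono P⊆Q (a ∨' b) (h , h′) = Over-mono P⊆Q a h , Over-mono P⊆Q b h′
  Over-mono P⊆Q (a ⇒ b) (h , h′) = Over-mono P⊆Q a h , Over-mono P⊆Q b h′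
  Over-mono P⊆Q ([ k ] χ) h = P⊆Q h

  Over-⋀ : ∀ P (as : List (Fm n)) → (∀ {a} → a ∈ as → Over P a) → Over P (⋀ as)
  Over-⋀ P [] h = tt
  Over-⋀ P (a ∷ as) h = h (here refl) , Over-⋀ P as (h ∘ there)

  Closed : List (Fm n) → Set
  Closed P = ∀ {k ψ} → [ k ] ψ ∈ P → Over P ψ × (∀ j → [ j ] ψ ∈ P)

  Over-boxesFrom : ∀ {P} → Closed P → ∀ {k ψ} (j : Fin n) → [ k ] ψ ∈ P → Over P (boxesFrom j ψ)
  Over-boxesFrom {P} closed {ψ = ψ} j kψ∈P = Over-⋀ P (boxList j ψ) each
    where
    each : ∀ {a} → a ∈ boxList j ψ → Over P a
    each a∈ with ∈-boxList⁻ a∈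
    ... | i , _ , refl = proj₂ (closed kψ∈P) i

  allBoxes : Fm n → List (Fm n)
  allBoxes χ = map (λ j → [ j ] χ) (allFin n)

  ∈-allBoxes : ∀ {χ} (j : Fin n) → [ j ] χ ∈ allBoxes χ
  ∈-allBoxes {χ} j = ∈-map⁺ (λ j → [ j ] χ) (∈-allFin j)

  closure : Fm n → List (Fm n)
  closure (var p) = var p ∷ []
  closure ⊤' = []
  closure (¬' a) = closure a
  closure (a ∧' b) = closure a ++ closure b
  closure (a ∨' b) = closure a ++ closure b
  closure (a ⇒ b) = closure a ++ closure b
  closure ([ k ] a) = allBoxes a ++ closure a

  private
    Over-++ˡ : ∀ {P} Q χ → Over P χ → Over (P ++ Q) χ
    Over-++ˡ Q = Over-mono (∈-++⁺ˡ {ys = Q})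

    Over-++ʳ : ∀ P {Q} χ → Over Q χ → Over (P ++ Q) χ
    Over-++ʳ P = Over-mono (∈-++⁺ʳ P)

    Over-++ : ∀ a b → Over (closure a) a → Over (closure b) b → Over (closure a ++ closure b) a × Over (closure a ++ closure b) b
    Over-++ a b ha hb = Over-++ˡ (closure b) a ha , Over-++ʳ (closure a) b hb

    Closed-++ : ∀ {P Q} → Closed P → Closed Q → Closed (P ++ Q)
    Closed-++ {P} {Q} cP cQ {ψ = ψ} m with ∈-++⁻ P m
    ... | inj₁ p = Over-++ˡ Q ψ (proj₁ (cP p)) , λ j → ∈-++⁺ˡ (proj₂ (cP p) j)
    ... | inj₂ q = Over-++ʳ P ψ (proj₁ (cQ q)) , λ j → ∈-++⁺ʳ P (proj₂ (cQ q) j)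

  Over-closure : ∀ χ → Over (closure χ) χ
  Over-closure (var p) = here refl
  Over-closure ⊤' = tt
  Over-closure (¬' χ) = Over-closure χ
  Over-closure (a ∧' b) = Over-++ a b (Over-closure a) (Over-closure b)
  Over-closure (a ∨' b) = Over-++ a b (Over-closure a) (Over-closure b)
  Over-closure (a ⇒ b) = Over-++ a b (Over-closure a) (Over-closure b)
  Over-closure ([ k ] χ) = ∈-++⁺ˡ (∈-allBoxes k)

  Closed-closure : ∀ χ → Closed (closure χ)
  Closed-closure (var p) (here ())
  Closed-closure (var p) (there ())
  Closed-closure ⊤' ()
  Closed-closure (¬' χ) = Closed-closure χ
  Closed-closure (a ∧' b) = Closed-++ (Closed-closure a) (Closed-closure b)
  Closed-closure (a ∨' b) = Closed-++ (Closed-closure a) (Closed-closure b)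
  Closed-closure (a ⇒ b) = Closed-++ (Closed-closure a) (Closed-closure b)
  Closed-closure ([ k ] χ) {ψ = ψ} m with ∈-++⁻ (allBoxes χ) m
  ... | inj₂ q = Over-++ʳ (allBoxes χ) ψ (proj₁ (Closed-closure χ q))
               , λ j → ∈-++⁺ʳ (allBoxes χ) (proj₂ (Closed-closure χ q) j)
  ... | inj₁ p with ∈-map⁻ (λ j → [ j ] χ) p
  ... | _ , _ , refl = Over-++ʳ (allBoxes χ) χ (Over-closure χ) , λ j → ∈-++⁺ˡ (∈-allBoxes j)

  beval-cong : ∀ {P v v′ b b′} → (∀ {p} → var p ∈ P → v p ≡ v′ p) → (∀ {k ψ} → [ k ] ψ ∈ P → b k ψ ≡ b′ k ψ) →
               ∀ χ → Over P χ → beval v b χ ≡ beval v′ b′ χ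
  beval-cong hv hb (var p) o = hv o
  beval-cong hv hb ⊤' o = refl
  beval-cong hv hb (¬' χ) o = cong not (beval-cong hv hb χ o)
  beval-cong hv hb (a ∧' c) (o , o′) = cong₂ _∧_ (beval-cong hv hb a o) (beval-cong hv hb c o′)
  beval-cong hv hb (a ∨' c) (o , o′) = cong₂ _∨_ (beval-cong hv hb a o) (beval-cong hv hb c o′)
  beval-cong hv hb (a ⇒ c) (o , o′) = cong₂ (λ x y → not x ∨ y) (beval-cong hv hb a o) (beval-cong hv hb c o′)
  beval-cong hv hb ([ k ] χ) o = hb o

  lit : Fm n → Bool → Fm n
  lit a true = a
  lit a false = ¬' a

  lit-clash : ∀ a {x y} → x ≢ y → ⊢ lit a x ⇒ ¬' lit a y
  lit-clash a {true} {true} x≢y = ⊥-elim (x≢y refl)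
  lit-clash a {true} {false} _ = taut-instance (x₀ ‵⇒ ‵¬ ‵¬ x₀) (a ∷ [])
  lit-clash a {false} {true} _ = ⇒-refl (¬' a)
  lit-clash a {false} {false} x≢y = ⊥-elim (x≢y refl)

  module _ (v : ℕ → Bool) (b : Fin n → Fm n → Bool) where

    beval-lit⁻ : ∀ a x → T (beval v b (lit a x)) → beval v b a ≡ x
    beval-lit⁻ a true e = Equivalence.to T-≡ e
    beval-lit⁻ a false e = Equivalence.to T-not-≡ e

    beval-lit-self : ∀ a → T (beval v b (lit a (beval v b a)))
    beval-lit-self a with beval v b a in e
    ... | true = Equivalence.from T-≡ e
    ... | false rewrite e = tt

    beval-⋀⁻ : ∀ as → T (beval v b (⋀ as)) → ∀ {a} → a ∈ as → T (beval v b a)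
    beval-⋀⁻ (a ∷ as) e (here refl) = proj₁ (Equivalence.to T-∧ e)
    beval-⋀⁻ (a ∷ as) e (there a∈) = beval-⋀⁻ as (proj₂ (Equivalence.to T-∧ e)) a∈

    beval-⋀⁺ : ∀ as → (∀ {a} → a ∈ as → T (beval v b a)) → T (beval v b (⋀ as))
    beval-⋀⁺ [] h = tt
    beval-⋀⁺ (a ∷ as) h = Equivalence.from T-∧ (h (here refl) , beval-⋀⁺ as (h ∘ there))

    beval-⋁⁺ : ∀ as {a} → a ∈ as → T (beval v b a) → T (beval v b (⋁ as))
    beval-⋁⁺ (a ∷ as) (here refl) e = Equivalence.from T-∨ (inj₁ e)
    beval-⋁⁺ (a′ ∷ as) (there a∈) e = Equivalence.from T-∨ (inj₂ (beval-⋁⁺ as a∈ e))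

  -- The bit an assignment to P gives a formula (junk false outside P).
  valueIn : (P : List (Fm n)) → Vec Bool (length P) → Fm n → Bool
  valueIn [] [] a = false
  valueIn (a′ ∷ P) (x ∷ A) a with a ≟ a′
  ... | yes _ = x
  ... | no _ = valueIn P A a

  boxed : Fm n → List (Fin n × Fm n)
  boxed ([ m ] ψ) = (m , ψ) ∷ []
  boxed _ = []

  boxedIn : List (Fm n) → List (Fin n × Fm n)
  boxedIn [] = []
  boxedIn (a ∷ P) = boxed a ++ boxedIn P

  ∈-boxedIn⁺ : ∀ {P m ψ} → [ m ] ψ ∈ P → (m , ψ) ∈ boxedIn P
  ∈-boxedIn⁺ (here refl) = here refl
  ∈-boxedIn⁺ {a ∷ P} (there mψ∈P) = ∈-++⁺ʳ (boxed a) (∈-boxedIn⁺ mψ∈P)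

  ∈-boxedIn⁻ : ∀ {P m ψ} → (m , ψ) ∈ boxedIn P → [ m ] ψ ∈ P
  ∈-boxedIn⁻ {a ∷ P} mψ∈ with ∈-++⁻ (boxed a) mψ∈
  ... | inj₁ mψ∈a = here (∈-boxed mψ∈a)
    where
    ∈-boxed : ∀ {a m ψ} → (m , ψ) ∈ boxed a → [ m ] ψ ≡ a
    ∈-boxed {[ _ ] _} (here refl) = refl
    ∈-boxed {var _} ()
    ∈-boxed {⊤'} ()
    ∈-boxed {¬' _} ()
    ∈-boxed {_ ∧' _} ()
    ∈-boxed {_ ∨' _} ()
    ∈-boxed {_ ⇒ _} ()
  ... | inj₂ mψ∈P = there (∈-boxedIn⁻ mψ∈P)

  tabulateOn : (P : List (Fm n)) → (Fm n → Bool) → Vec Bool (length P)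
  tabulateOn [] f = []
  tabulateOn (a ∷ P) f = f a ∷ tabulateOn P f

  valueIn-tabulateOn : ∀ P f {a} → a ∈ P → valueIn P (tabulateOn P f) a ≡ f a
  valueIn-tabulateOn (a′ ∷ P) f {a} a∈ with a ≟ a′ | a∈
  ... | yes refl | _ = refl
  ... | no a≢a′ | here a≡a′ = ⊥-elim (a≢a′ a≡a′)
  ... | no _ | there a∈′ = valueIn-tabulateOn P f a∈′

module Atoms {n : ℕ} (P : List (Fm n)) where

  Atom : Set
  Atom = Vec Bool (length P)

  atoms : List Atom
  atoms = vecs (length P)

  infix 9 _⟦_⟧

  _⟦_⟧ : Atom → Fm n → Bool
  A ⟦ a ⟧ = valueIn P A a

  eval : Atom → Fm n → Bool
  eval A = beval (λ p → A ⟦ var p ⟧) (λ k ψ → A ⟦ [ k ] ψ ⟧)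

  char : Atom → Fm n
  char A = ⋀ (map (λ a → lit a (A ⟦ a ⟧)) P)

  char-lit : ∀ A {a x} → a ∈ P → A ⟦ a ⟧ ≡ x → ⊢ char A ⇒ lit a x
  char-lit A a∈ refl = ⋀-elim _ (∈-map⁺ (λ a → lit a (A ⟦ a ⟧)) a∈)

  beval-char : ∀ v b A → T (beval v b (char A)) → ∀ {a} → a ∈ P → beval v b a ≡ A ⟦ a ⟧
  beval-char v b A e {a} a∈ = beval-lit⁻ v b a (A ⟦ a ⟧) (beval-⋀⁻ v b _ e (∈-map⁺ (λ a → lit a (A ⟦ a ⟧)) a∈))

  char-decides : ∀ A χ → Over P χ → ⊢ char A ⇒ lit χ (eval A χ)
  char-decides A χ o = ⇒-taut λ v b e →
    subst (λ x → T (beval v b (lit χ x))) (beval-cong (beval-char v b A e) (beval-char v b A e) χ o) (beval-lit-self v b χ)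

  char-cover : ⊢ ⋁ (map char atoms)
  char-cover = ⊢-taut λ v b →
    beval-⋁⁺ v b _ (∈-map⁺ char (∈-vecs (tabulateOn P (beval v b)))) (beval-⋀⁺ v b _ (literal-true v b))
    where
    literal-true : ∀ v b {c} → c ∈ map (λ a → lit a (tabulateOn P (beval v b) ⟦ a ⟧)) P → T (beval v b c)
    literal-true v b c∈ with ∈-map⁻ (λ a → lit a (tabulateOn P (beval v b) ⟦ a ⟧)) c∈
    ... | a , a∈ , refl rewrite valueIn-tabulateOn P (beval v b) a∈ = beval-lit-self v b a

does-≟-true : ∀ b → does (b Bool.≟ true) ≡ b
does-≟-true true = refl
does-≟-true false = refl

⇔⇒does≡ : ∀ {X Y : Set} (x? : Dec X) (y? : Dec Y) → X ⇔ Y → does x? ≡ does y?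
⇔⇒does≡ (yes _) (yes _) _ = refl
⇔⇒does≡ (yes x) (no ¬y) X⇔Y = ⊥-elim (¬y (Equivalence.to X⇔Y x))
⇔⇒does≡ (no ¬x) (yes y) X⇔Y = ⊥-elim (¬x (Equivalence.from X⇔Y y))
⇔⇒does≡ (no _) (no _) _ = refl

module Forcing {n N : ℕ} (R : Frame n N) (V : ℕ → Fin N → Bool) where

  infix 2 _⊩_

  _⊩_ : Fin N → Fm n → Set
  w ⊩ χ = _⊩[_]_ R w V χ

  forces? : ∀ w χ → Dec (w ⊩ χ)
  forces? w (var p) = V p w Bool.≟ true
  forces? w ⊤' = yes tt
  forces? w (¬' χ) = ¬? (forces? w χ)
  forces? w (a ∧' b) = forces? w a ×-dec forces? w b
  forces? w (a ∨' b) = forces? w a ⊎-dec forces? w b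
  forces? w (a ⇒ b) = forces? w a →-dec forces? w b
  forces? w ([ k ] χ) = ¬? (Fin.any? λ v → (R k w v Bool.≟ true) ×-dec ¬? (forces? v χ))

  forcesᵇ : Fin N → Fm n → Bool
  forcesᵇ w χ = does (forces? w χ)

  forcesᵇ-beval : ∀ w χ → forcesᵇ w χ ≡ beval (λ p → forcesᵇ w (var p)) (λ k ψ → forcesᵇ w ([ k ] ψ)) χ
  forcesᵇ-beval w (var p) = refl
  forcesᵇ-beval w ⊤' = refl
  forcesᵇ-beval w (¬' χ) = cong not (forcesᵇ-beval w χ)
  forcesᵇ-beval w (a ∧' b) = cong₂ _∧_ (forcesᵇ-beval w a) (forcesᵇ-beval w b)
  forcesᵇ-beval w (a ∨' b) = cong₂ _∨_ (forcesᵇ-beval w a) (forcesᵇ-beval w b)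
  forcesᵇ-beval w (a ⇒ b) = cong₂ (λ x y → not x ∨ y) (forcesᵇ-beval w a) (forcesᵇ-beval w b)
  forcesᵇ-beval w ([ k ] χ) = refl

  forcesᵇ⇒⊩ : ∀ w χ → forcesᵇ w χ ≡ true → w ⊩ χ
  forcesᵇ⇒⊩ w χ with forces? w χ
  ... | yes h = λ _ → h

  ⊩⇒forcesᵇ : ∀ w χ → w ⊩ χ → forcesᵇ w χ ≡ true
  ⊩⇒forcesᵇ w χ h with forces? w χ
  ... | yes _ = refl
  ... | no ¬h = ⊥-elim (¬h h)

  ⊩-taut : ∀ {χ} → Tautology χ → ∀ w → w ⊩ χ
  ⊩-taut {χ} t w = forcesᵇ⇒⊩ w χ (trans (forcesᵇ-beval w χ) (t _ _))

  ⊩-by-contradiction : ∀ w χ → ¬ ¬ (w ⊩ χ) → w ⊩ χ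
  ⊩-by-contradiction w χ = decidable-stable (forces? w χ)

  ⊩□-elim : ∀ {w k} ψ → w ⊩ [ k ] ψ → ∀ v → Rel R k w v → v ⊩ ψ
  ⊩□-elim ψ h v wv = ⊩-by-contradiction v ψ λ ¬ψ → h (v , wv , ¬ψ)

  ⊩□-intro : ∀ {w k} ψ → (∀ v → Rel R k w v → v ⊩ ψ) → w ⊩ [ k ] ψ
  ⊩□-intro ψ h (v , wv , ¬ψ) = ¬ψ (h v wv)

  ⊩⋀-elim : ∀ {w} as → w ⊩ ⋀ as → ∀ {a} → a ∈ as → w ⊩ a
  ⊩⋀-elim (a ∷ as) (h , _) (here refl) = h
  ⊩⋀-elim (a ∷ as) (_ , h) (there a∈) = ⊩⋀-elim as h a∈

  ⊩⋀-intro : ∀ {w} as → (∀ {a} → a ∈ as → w ⊩ a) → w ⊩ ⋀ as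
  ⊩⋀-intro [] h = tt
  ⊩⋀-intro (a ∷ as) h = h (here refl) , ⊩⋀-intro as (h ∘ there)

  ⊩boxesFrom-elim : ∀ {w} {k j : Fin n} ψ → w ⊩ boxesFrom k ψ → k Fin.≤ j → w ⊩ [ j ] ψ
  ⊩boxesFrom-elim ψ h k≤j = ⊩⋀-elim _ h (∈-boxList⁺ k≤j)

  ⊩boxesFrom-intro : ∀ {w} (k : Fin n) ψ → (∀ j → k Fin.≤ j → w ⊩ [ j ] ψ) → w ⊩ boxesFrom k ψ
  ⊩boxesFrom-intro {w} k ψ h = ⊩⋀-intro (boxList k ψ) each
    where
    each : ∀ {a} → a ∈ boxList k ψ → w ⊩ a
    each a∈ with ∈-boxList⁻ a∈
    ... | j , k≤j , refl = h j k≤j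

module FrameProperties {n N : ℕ} {R : Frame n N} (J : IsJnFrame R) (HL : HereditarilyLinear R) where
  open IsJnFrame J renaming (trans to Rel-trans)

  Rel-label-unique : ∀ {a b x y} → Rel R a x y → Rel R b x y → a ≡ b
  Rel-label-unique {a} {b} {x} {y} xy xy′ with Fin.<-cmp a b
  ... | tri< a<b _ _ = ⊥-elim (irrefl a x (cond3 a b a<b x x y xy xy′))
  ... | tri≈ _ a≡b _ = a≡b
  ... | tri> _ _ b<a = ⊥-elim (irrefl b x (cond3 b a b<a x x y xy′ xy))

  trans-≥ʳ : ∀ {k m : Fin n} {x y z} → k Fin.≤ m → Rel R k x y → Rel R m y z → Rel R k x z
  trans-≥ʳ {k} {m} {x} {y} {z} k≤m xy yz with Fin.<-cmp k m
  ... | tri< k<m _ _ = cond2 k m k<m x y z xy yz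
  ... | tri≈ _ refl _ = Rel-trans k x y z xy yz
  ... | tri> _ _ m<k = ⊥-elim (ℕ.<⇒≱ m<k k≤m)

  trans-≥ˡ : ∀ {k m : Fin n} {x y z} → k Fin.≤ m → Rel R m x y → Rel R k y z → Rel R k x z
  trans-≥ˡ {k} {m} {x} {y} {z} k≤m xy yz with Fin.<-cmp k m
  ... | tri< k<m _ _ = cond1 k m k<m x y z xy yz
  ... | tri≈ _ refl _ = Rel-trans k x y z xy yz
  ... | tri> _ _ m<k = ⊥-elim (ℕ.<⇒≱ m<k k≤m)

  Rel-lower-from-higher : ∀ {k m : Fin n} {w y z} → k Fin.< m → Rel R m w y → Rel R k w z → Rel R k y z
  Rel-lower-from-higher {k} {m} {w} {y} {z} k<m wy wz with y Fin.≟ z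
  ... | yes refl = ⊥-elim (Fin.<⇒≢ k<m (Rel-label-unique wz wy))
  ... | no y≢z with HL y z y≢z
  ... | j , inj₁ yz with Fin.<-cmp j k
  ...   | tri≈ _ refl _ = yz
  ...   | tri> _ _ k<j = ⊥-elim (Fin.<⇒≢ k<m (Rel-label-unique (cond3 k j k<j w y z wz yz) wy))
  ...   | tri< j<k _ _ = ⊥-elim (Fin.<⇒≢ j<k (Rel-label-unique (cond1 j m (Fin.<-trans j<k k<m) w y z wy yz) wz))
  Rel-lower-from-higher {k} {m} {w} {y} {z} k<m wy wz | no y≢z | j , inj₂ zy with Fin.<-cmp j k
  ...   | tri≈ _ refl _ = ⊥-elim (Fin.<⇒≢ k<m (Rel-label-unique (Rel-trans k w z y wz zy) wy))
  ...   | tri> _ _ k<j = ⊥-elim (Fin.<⇒≢ k<m (Rel-label-unique (cond2 k j k<j w z y wz zy) wy))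
  ...   | tri< j<k _ _ = ⊥-elim (Fin.<⇒≢ (Fin.<-trans j<k k<m) (Rel-label-unique (cond1 j k j<k w z y wz zy) wy))

  m-successors-comparable : ∀ {m : Fin n} {w y z} → Rel R m w y → Rel R m w z → y ≢ z →
                            ∃[ j ] (m Fin.≤ j × (Rel R j y z ⊎ Rel R j z y))
  m-successors-comparable {m} {w} {y} {z} wy wz y≢z with HL y z y≢z
  ... | j , yz⊎zy with Fin.<-cmp j m
  ... | tri≈ _ refl _ = j , Fin.≤-refl , yz⊎zy
  ... | tri> _ _ m<j = j , ℕ.<⇒≤ m<j , yz⊎zy
  ... | tri< j<m _ _ = ⊥-elim (Fin.<⇒≢ j<m (lower yz⊎zy))
    where
    lower : Rel R j y z ⊎ Rel R j z y → j ≡ m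
    lower (inj₁ yz) = Rel-label-unique (cond1 j m j<m w y z wy yz) wz
    lower (inj₂ zy) = Rel-label-unique (cond1 j m j<m w z y wz zy) wy

module Soundness {n N : ℕ} (R : Frame n N) (J : IsJnFrame R) (HL : HereditarilyLinear R) (V : ℕ → Fin N → Bool) where
  open Forcing R V
  open FrameProperties J HL
  open IsJnFrame J using (cwf) renaming (trans to Rel-trans)

  löb-valid : ∀ k ψ w → w ⊩ [ k ] ([ k ] ψ ⇒ ψ) ⇒ [ k ] ψ
  löb-valid k ψ w h = ⊩□-intro ψ λ v wv → below v (cwf k v) wv
    where
    below : ∀ v → Acc (flip (Rel R k)) v → Rel R k w v → v ⊩ ψ
    below v (acc rs) wv = ⊩□-elim ([ k ] ψ ⇒ ψ) h v wv (⊩□-intro ψ λ u vu → below u (rs vu) (Rel-trans k w v u wv vu))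

  lin-valid : ∀ m φ ψ w → w ⊩ [ m ] (boxesFrom m φ ⇒ ψ) ∨' [ m ] ((boxesFrom m ψ ∧' ψ) ⇒ φ)
  lin-valid m φ ψ w with forces? w ([ m ] (boxesFrom m φ ⇒ ψ))
  ... | yes h = inj₁ h
  ... | no ¬h = inj₂ (⊩□-intro (boxesFrom m ψ ∧' ψ ⇒ φ) λ z wz (⊩Bψ , ⊩ψ) → ⊩-by-contradiction z φ λ ¬φ →
          ¬h (⊩□-intro (boxesFrom m φ ⇒ ψ) λ y wy ⊩Bφ → ⊩-by-contradiction y ψ λ ¬ψ →
            conflict wy wz ⊩Bφ ¬φ ⊩Bψ ¬ψ ⊩ψ))
    where
    conflict : ∀ {y z} → Rel R m w y → Rel R m w z → y ⊩ boxesFrom m φ → ¬ (z ⊩ φ) →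
               z ⊩ boxesFrom m ψ → ¬ (y ⊩ ψ) → z ⊩ ψ → Empty
    conflict {y} {z} wy wz ⊩Bφ ¬φ ⊩Bψ ¬ψ ⊩ψ with y Fin.≟ z
    ... | yes refl = ¬ψ ⊩ψ
    ... | no y≢z with m-successors-comparable wy wz y≢z
    ... | j , m≤j , inj₁ yz = ¬φ (⊩□-elim φ (⊩boxesFrom-elim φ ⊩Bφ m≤j) z yz)
    ... | j , m≤j , inj₂ zy = ¬ψ (⊩□-elim ψ (⊩boxesFrom-elim ψ ⊩Bψ m≤j) y zy)

  sound : ∀ {χ} → ⊢ χ → ∀ w → w ⊩ χ
  sound (taut t) = ⊩-taut t
  sound (K k a b) w h g = ⊩□-intro b λ v wv → ⊩□-elim (a ⇒ b) h v wv (⊩□-elim a g v wv)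
  sound (Löb k a) = löb-valid k a
  sound (ax3 k m k≤m a) w h = ⊩□-intro ([ m ] a) λ v wv → ⊩□-intro a λ u vu → ⊩□-elim a h u (trans-≥ʳ k≤m wv vu)
  sound (ax4 k m k≤m a) w h = ⊩□-intro ([ k ] a) λ v wv → ⊩□-intro a λ u vu → ⊩□-elim a h u (trans-≥ˡ k≤m wv vu)
  sound (ax5 k m k<m a) w h = ⊩□-intro (⟨ k ⟩ a) λ y wy ⊩□¬a →
    h (⊩□-intro (¬' a) λ z wz → ⊩□-elim (¬' a) ⊩□¬a z (Rel-lower-from-higher k<m wy wz))
  sound (lin m a b) = lin-valid m a b
  sound (mp d e) w = sound d w (sound e w)
  sound (nec k {χ} d) w = ⊩□-intro χ λ v _ → sound d v

maximal : ∀ {n p} {Q : Fin n → Set p} → (∀ i → Dec (Q i)) → ∀ {i} → Q i → ∃[ k ] (Q k × (∀ j → k Fin.< j → ¬ Q j))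
maximal {Q = Q} Q? {i} Qi = above (Fin.>-wellFounded i) Qi
  where
  above : ∀ {i} → Acc Fin._>_ i → Q i → ∃[ k ] (Q k × (∀ j → k Fin.< j → ¬ Q j))
  above {i} (acc rs) Qi with Fin.any? (λ j → i Fin.<? j ×-dec Q? j)
  ... | yes (j , i<j , Qj) = above (rs i<j) Qj
  ... | no none = i , Qi , λ j i<j Qj → none (j , i<j , Qj)

module Steps {n : ℕ} (P : List (Fm n)) (closed : Closed P) where
  open Atoms P

  Boxes : List (Fin n × Fm n)
  Boxes = boxedIn P

  Over-∧boxesFrom : ∀ {k ψ} → (k , ψ) ∈ Boxes → Over P (ψ ∧' boxesFrom k ψ)
  Over-∧boxesFrom {k} kψ∈ = proj₁ (closed (∈-boxedIn⁻ kψ∈)) , Over-boxesFrom closed k (∈-boxedIn⁻ kψ∈)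

  -- B may be the immediate <ₖ-successor of A in a word.
  StepAt : Fin n → Atom → Atom → Fin n × Fm n → Set
  StepAt k A B (m , ψ) with Fin.<-cmp m k
  ... | tri< _ _ _ = A ⟦ [ m ] ψ ⟧ ≡ B ⟦ [ m ] ψ ⟧
  ... | tri≈ _ _ _ = A ⟦ [ m ] ψ ⟧ ≡ eval B (ψ ∧' boxesFrom m ψ)
  ... | tri> _ _ _ = A ⟦ [ m ] ψ ⟧ ≡ true

  stepAt? : ∀ k A B b → Dec (StepAt k A B b)
  stepAt? k A B (m , ψ) with Fin.<-cmp m k
  ... | tri< _ _ _ = A ⟦ [ m ] ψ ⟧ Bool.≟ B ⟦ [ m ] ψ ⟧
  ... | tri≈ _ _ _ = A ⟦ [ m ] ψ ⟧ Bool.≟ eval B (ψ ∧' boxesFrom m ψ)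
  ... | tri> _ _ _ = A ⟦ [ m ] ψ ⟧ Bool.≟ true

  Step : Fin n → Atom → Atom → Set
  Step k A B = All (StepAt k A B) Boxes

  step? : ∀ k A B → Dec (Step k A B)
  step? k A B = All.all? (stepAt? k A B) Boxes

  Final : Atom → Set
  Final A = All (λ (m , ψ) → A ⟦ [ m ] ψ ⟧ ≡ true) Boxes

  final? : ∀ A → Dec (Final A)
  final? A = All.all? (λ (m , ψ) → A ⟦ [ m ] ψ ⟧ Bool.≟ true) Boxes

  Refutes : Fin n → Atom → Set
  Refutes k A = Any (λ (m , ψ) → m ≡ k × A ⟦ [ m ] ψ ⟧ ≡ false) Boxes

  refutes? : ∀ k A → Dec (Refutes k A)
  refutes? k A = Any.any? (λ (m , ψ) → (m Fin.≟ k) ×-dec (A ⟦ [ m ] ψ ⟧ Bool.≟ false)) Boxes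

  nonFinal-refutes : ∀ A → ¬ Final A → ∃[ k ] Refutes k A
  nonFinal-refutes A ¬final with find (¬All⇒Any¬ (λ (m , ψ) → A ⟦ [ m ] ψ ⟧ Bool.≟ true) Boxes ¬final)
  ... | (m , ψ) , mψ∈ , ≢true = m , lose mψ∈ (refl , ¬-not ≢true)

  -- The canonical k-successor: for the largest k at which A refutes a box,
  -- char A proves ⟨k⟩Γ, and Γ is inconsistent with char B unless Step k A B.
  module Successor (k : Fin n) (A : Atom) (refuted : Refutes k A) (top : ∀ m → k Fin.< m → ¬ Refutes m A) where

    required : Fin n × Fm n → Fm n
    required (m , ψ) with Fin.<-cmp m k
    ... | tri< _ _ _ = lit ([ m ] ψ) (A ⟦ [ m ] ψ ⟧)
    ... | tri≈ _ _ _ = if A ⟦ [ m ] ψ ⟧ then ψ ∧' boxesFrom m ψ else ⊤'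
    ... | tri> _ _ _ = ⊤'

    avoided : Fin n × Fm n → Fm n
    avoided (m , ψ) with Fin.<-cmp m k
    ... | tri≈ _ _ _ = if A ⟦ [ m ] ψ ⟧ then ⊥' else ψ ∧' boxesFrom m ψ
    ... | _ = ⊥'

    Γ : Fm n
    Γ = ¬' ⋁ (map avoided Boxes) ∧' ⋀ (map required Boxes)

    ◇⊤ : ⊢ char A ⇒ ⟨ k ⟩ (¬' ⊥')
    ◇⊤ with find refuted
    ... | (_ , ψ) , kψ∈ , refl , e =
      char-lit A (∈-boxedIn⁻ kψ∈) e ⨾ ¬□⇒◇¬ k ψ ⨾ ◇-mono k (taut-instance (‵¬ x₀ ‵⇒ ‵¬ ‵¬ ‵⊤) (ψ ∷ []))

    □required : ∀ {b} → b ∈ Boxes → ⊢ char A ⇒ [ k ] required b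
    □required {m , ψ} b∈ with Fin.<-cmp m k
    ... | tri< m<k _ _ with A ⟦ [ m ] ψ ⟧ in e
    ...   | true = char-lit A (∈-boxedIn⁻ b∈) e ⨾ ax4 m k (ℕ.<⇒≤ m<k) ψ
    ...   | false = char-lit A (∈-boxedIn⁻ b∈) e ⨾ ¬□⇒◇¬ m ψ ⨾ ax5 m k m<k (¬' ψ) ⨾ □-mono k (◇¬⇒¬□ m ψ)
    □required {m , ψ} b∈ | tri≈ _ refl _ with A ⟦ [ m ] ψ ⟧ in e
    ...   | true = char-lit A (∈-boxedIn⁻ b∈) e ⨾ □⇒□∧boxesFrom m ψ
    ...   | false = ⇒-weaken (nec k ⊢⊤)
    □required {m , ψ} b∈ | tri> _ _ _ = ⇒-weaken (nec k ⊢⊤)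

    □⋀required : ⊢ char A ⇒ [ k ] ⋀ (map required Boxes)
    □⋀required = □-⋀-intro k _ each
      where
      each : ∀ {c} → c ∈ map required Boxes → ⊢ char A ⇒ [ k ] c
      each c∈ with ∈-map⁻ required c∈
      ... | b , b∈ , refl = □required b∈

    persistent-avoided : ∀ b → Persistent k (avoided b)
    persistent-avoided (m , ψ) with Fin.<-cmp m k
    ... | tri< _ _ _ = persistent-⊥ k
    ... | tri> _ _ _ = persistent-⊥ k
    ... | tri≈ _ refl _ with A ⟦ [ m ] ψ ⟧
    ...   | true = persistent-⊥ k
    ...   | false = persistent-∧boxesFrom k ψ

    persistent-⋁avoided : ∀ Q → Persistent k (⋁ (map avoided Q))
    persistent-⋁avoided [] = persistent-⊥ k
    persistent-⋁avoided (b ∷ Q) = persistent-∨ k (persistent-avoided b) (persistent-⋁avoided Q)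

    ◇¬avoided : ∀ {b} → b ∈ Boxes → ⊢ char A ⇒ ⟨ k ⟩ (¬' avoided b)
    ◇¬avoided {m , ψ} b∈ with Fin.<-cmp m k
    ... | tri< _ _ _ = ◇⊤
    ... | tri> _ _ _ = ◇⊤
    ... | tri≈ _ refl _ with A ⟦ [ m ] ψ ⟧ in e
    ...   | true = ◇⊤
    ...   | false = char-lit A (∈-boxedIn⁻ b∈) e ⨾ ¬□⇒◇¬ k ψ
                    ⨾ ◇-mono k (taut-instance (‵¬ x₀ ‵⇒ ‵¬ (x₀ ‵∧ x₁)) (ψ ∷ boxesFrom k ψ ∷ []))

    ◇¬⋁avoided : ∀ Q → (∀ {b} → b ∈ Q → b ∈ Boxes) → ⊢ char A ⇒ ⟨ k ⟩ (¬' ⋁ (map avoided Q))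
    ◇¬⋁avoided [] _ = ◇⊤
    ◇¬⋁avoided (b ∷ Q) Q⊆ = ∧-intro (◇¬avoided (Q⊆ (here refl))) (◇¬⋁avoided Q (Q⊆ ∘ there))
                            ⨾ ◇¬-merge k (persistent-avoided b) (persistent-⋁avoided Q)

    ◇Γ : ⊢ char A ⇒ ⟨ k ⟩ Γ
    ◇Γ = ∧-intro (◇¬⋁avoided Boxes (λ b∈ → b∈)) □⋀required ⨾ ◇-∧-□ k _ _

    Γ⇒required : ∀ {b} → b ∈ Boxes → ⊢ Γ ⇒ required b
    Γ⇒required b∈ = ∧-elimʳ _ _ ⨾ ⋀-elim _ (∈-map⁺ required b∈)

    Γ⇒¬avoided : ∀ {b} → b ∈ Boxes → ⊢ Γ ⇒ ¬' avoided b
    Γ⇒¬avoided b∈ = ∧-elimˡ _ _ ⨾ contrapose (⋁-intro _ (∈-map⁺ avoided b∈))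

    Γ-excludes : ∀ B {b} → b ∈ Boxes → ¬ StepAt k A B b → ⊢ Γ ∧' char B ⇒ ⊥'
    Γ-excludes B {m , ψ} b∈ ¬step with Fin.<-cmp m k | Γ⇒required b∈ | Γ⇒¬avoided b∈
    ... | tri< _ _ _ | Γ⇒lit | _ = ⇒-clash Γ⇒lit (char-lit B (∈-boxedIn⁻ b∈) refl) (lit-clash ([ m ] ψ) ¬step)
    ... | tri> _ _ k<m | _ | _ = ⊥-elim (top m k<m (lose b∈ (refl , ¬-not ¬step)))
    ... | tri≈ _ refl _ | Γ⇒req | Γ⇒¬avoid =
      ⇒-clash (Γ⇒lit Γ⇒req Γ⇒¬avoid) (char-decides B (ψ ∧' boxesFrom k ψ) (Over-∧boxesFrom b∈)) (lit-clash _ ¬step)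
      where
      Γ⇒lit : ⊢ Γ ⇒ (if A ⟦ [ k ] ψ ⟧ then ψ ∧' boxesFrom k ψ else ⊤') →
              ⊢ Γ ⇒ ¬' (if A ⟦ [ k ] ψ ⟧ then ⊥' else ψ ∧' boxesFrom k ψ) →
              ⊢ Γ ⇒ lit (ψ ∧' boxesFrom k ψ) (A ⟦ [ k ] ψ ⟧)
      Γ⇒lit with A ⟦ [ k ] ψ ⟧
      ... | true = λ Γ⇒α _ → Γ⇒α
      ... | false = λ _ Γ⇒¬α → Γ⇒¬α

    char⇒◇ : ∀ θ → (∀ B → Step k A B → ⊢ char B ⇒ θ) → ⊢ char A ⇒ ⟨ k ⟩ θ
    char⇒◇ θ h = ◇Γ ⨾ ◇-mono k (∧-intro (⇒-refl Γ) (⇒-weaken char-cover) ⨾ ⋁-elim-∧ _ each)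
      where
      each : ∀ {c} → c ∈ map char atoms → ⊢ Γ ∧' c ⇒ θ
      each c∈ with ∈-map⁻ char c∈
      ... | B , _ , refl with step? k A B
      ... | yes s = ∧-elimʳ _ _ ⨾ h B s
      ... | no ¬s with find (¬All⇒Any¬ (stepAt? k A B) Boxes ¬s)
      ... | _ , b∈ , ¬sb = Γ-excludes B b∈ ¬sb ⨾ ex-falso θ

⊓≡⇒≡ˡ : ∀ {a b c} → a ⊓ b ≡ c → c ℕ.< b → a ≡ c
⊓≡⇒≡ˡ {a} {b} a⊓b≡c c<b with ℕ.≤-total a b
... | inj₁ a≤b = trans (sym (ℕ.m≤n⇒m⊓n≡m a≤b)) a⊓b≡c
... | inj₂ b≤a = ⊥-elim (ℕ.<-irrefl (trans (sym a⊓b≡c) (ℕ.m≥n⇒m⊓n≡n b≤a)) c<b)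

⊓≡⇒≡ʳ : ∀ {a b c} → a ⊓ b ≡ c → c ℕ.< a → b ≡ c
⊓≡⇒≡ʳ {a} {b} a⊓b≡c = ⊓≡⇒≡ˡ (trans (ℕ.⊓-comm b a) a⊓b≡c)

module LabelledChain {n N : ℕ} (lab : Fin N → Fin N → ℕ)
  (lab-⊓ : ∀ {i j l} → i Fin.< j → j Fin.< l → lab i l ≡ lab i j ⊓ lab j l)
  (lab-< : ∀ {i j} → i Fin.< j → lab i j ℕ.< n) where

  chain : Frame n N
  chain m i j = (toℕ i ℕ.<ᵇ toℕ j) ∧ (lab i j ℕ.≡ᵇ toℕ m)

  chain-Rel⁺ : ∀ {m i j} → i Fin.< j → lab i j ≡ toℕ m → Rel chain m i j
  chain-Rel⁺ {m} {i} {j} i<j lab≡m =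
    Equivalence.to T-≡ (Equivalence.from T-∧ (ℕ.<⇒<ᵇ i<j , ℕ.≡⇒≡ᵇ (lab i j) (toℕ m) lab≡m))

  chain-Rel⁻ : ∀ {m i j} → Rel chain m i j → i Fin.< j × lab i j ≡ toℕ m
  chain-Rel⁻ {m} {i} {j} r =
    let i<ᵇj , lab≡ᵇm = Equivalence.to T-∧ (Equivalence.from T-≡ r)
    in ℕ.<ᵇ⇒< (toℕ i) (toℕ j) i<ᵇj , ℕ.≡ᵇ⇒≡ (lab i j) (toℕ m) lab≡ᵇm

  private
    compose : ∀ {k m m′ : Fin n} {x y z} → toℕ k ⊓ toℕ m ≡ toℕ m′ →
              Rel chain k x y → Rel chain m y z → Rel chain m′ x z
    compose k⊓m≡m′ xy yz with chain-Rel⁻ xy | chain-Rel⁻ yz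
    ... | x<y , lab≡k | y<z , lab≡m =
      chain-Rel⁺ (ℕ.<-trans x<y y<z) (trans (lab-⊓ x<y y<z) (trans (cong₂ _⊓_ lab≡k lab≡m) k⊓m≡m′))

    cond3 : ∀ k m → k Fin.< m → ∀ x y z → Rel chain k x z → Rel chain m y z → Rel chain k x y
    cond3 k m k<m x y z xz yz with chain-Rel⁻ xz | chain-Rel⁻ yz | Fin.<-cmp x y
    ... | x<z , labxz≡k | y<z , labyz≡m | tri< x<y _ _ =
      chain-Rel⁺ x<y (⊓≡⇒≡ˡ (trans (sym (trans (lab-⊓ x<y y<z) (cong (lab x y ⊓_) labyz≡m))) labxz≡k) k<m)
    ... | _ , labxz≡k | _ , labyz≡m | tri≈ _ refl _ = ⊥-elim (ℕ.<-irrefl (trans (sym labxz≡k) labyz≡m) k<m)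
    ... | x<z , labxz≡k | _ , labyz≡m | tri> _ _ y<x =
      ⊥-elim (ℕ.<⇒≱ k<m (subst (ℕ._≤ toℕ k) lab-yx⊓k≡m (ℕ.m⊓n≤n (lab y x) (toℕ k))))
      where
      lab-yx⊓k≡m : lab y x ⊓ toℕ k ≡ toℕ m
      lab-yx⊓k≡m = trans (sym (trans (lab-⊓ y<x x<z) (cong (lab y x ⊓_) labxz≡k))) labyz≡m

  chain-isJn : IsJnFrame chain
  chain-isJn = record
    { irrefl = λ k x r → ℕ.<-irrefl refl (proj₁ (chain-Rel⁻ r))
    ; trans = λ k x y z → compose (ℕ.⊓-idem (toℕ k))
    ; cwf = λ k → Subrelation.wellFounded (proj₁ ∘ chain-Rel⁻) Fin.>-wellFounded
    ; cond1 = λ k m k<m x y z → compose (ℕ.m≥n⇒m⊓n≡n (ℕ.<⇒≤ k<m))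
    ; cond2 = λ k m k<m x y z → compose (ℕ.m≤n⇒m⊓n≡m (ℕ.<⇒≤ k<m))
    ; cond3 = cond3
    }

  chain-hereditarilyLinear : HereditarilyLinear chain
  chain-hereditarilyLinear x y x≢y with Fin.<-cmp x y
  ... | tri< x<y _ _ = fromℕ< (lab-< x<y) , inj₁ (chain-Rel⁺ x<y (sym (Fin.toℕ-fromℕ< (lab-< x<y))))
  ... | tri≈ _ x≡y _ = ⊥-elim (x≢y x≡y)
  ... | tri> _ _ y<x = fromℕ< (lab-< y<x) , inj₂ (chain-Rel⁺ y<x (sym (Fin.toℕ-fromℕ< (lab-< y<x))))

module Words {n : ℕ} (P : List (Fm n)) (closed : Closed P) where
  open Atoms P
  open Steps P closed

  data Word : Atom → Set where
    end  : ∀ {A} → Final A → Word A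
    step : ∀ {A B} k → Step k A B → Word B → Word A

  steps : ∀ {A} → Word A → ℕ
  steps (end _) = 0
  steps (step _ _ w) = suc (steps w)

  size : ∀ {A} → Word A → ℕ
  size w = suc (steps w)

  atomAt : ∀ {A} (w : Word A) → Fin (size w) → Atom
  atomAt {A} w zero = A
  atomAt (step _ _ w) (suc i) = atomAt w i

  -- The least step label between positions i < j (junk 0 when i ≥ j).
  label : ∀ {A} (w : Word A) → Fin (size w) → Fin (size w) → ℕ
  label (step k _ w) zero (suc zero) = toℕ k
  label (step k _ w) zero (suc (suc j)) = toℕ k ⊓ label w zero (suc j)
  label (step k _ w) (suc i) (suc j) = label w i j
  label _ _ _ = 0

  label-⊓ : ∀ {A} (w : Word A) {i j l} → i Fin.< j → j Fin.< l → label w i l ≡ label w i j ⊓ label w j l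
  label-⊓ (step k _ w) {zero} {suc zero} {suc (suc l)} _ _ = refl
  label-⊓ (step k _ w) {zero} {suc (suc j)} {suc (suc l)} _ (s≤s j<l) =
    trans (cong (toℕ k ⊓_) (label-⊓ w {zero} {suc j} {suc l} (s≤s z≤n) j<l)) (sym (ℕ.⊓-assoc (toℕ k) _ _))
  label-⊓ (step k _ w) {zero} {suc zero} {suc zero} _ (s≤s ())
  label-⊓ (step k _ w) {suc i} {suc j} {suc l} (s≤s i<j) (s≤s j<l) = label-⊓ w i<j j<l

  label-< : ∀ {A} (w : Word A) {i j} → i Fin.< j → label w i j ℕ.< n
  label-< (step k _ w) {zero} {suc zero} _ = Fin.toℕ<n k
  label-< (step k _ w) {zero} {suc (suc j)} _ = ℕ.≤-<-trans (ℕ.m⊓n≤m _ _) (Fin.toℕ<n k)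
  label-< (step k _ w) {suc i} {suc j} (s≤s i<j) = label-< w i<j

  module Frame {A} (w : Word A) where
    open LabelledChain (label w) (label-⊓ w) (label-< w) public

    valuation : ℕ → Fin (size w) → Bool
    valuation p i = atomAt w i ⟦ var p ⟧

    open Forcing chain valuation public

  module Extension {A B} (k : Fin n) (s : Step k A B) (w : Word B) where
    private
      module Big = Frame (step k s w)
      module Small = Frame w

    -- Positions after the head form a generated subframe isomorphic to w.
    ⊩-tail : ∀ i χ → (suc i Big.⊩ χ) ⇔ (i Small.⊩ χ)
    ⊩-tail i (var p) = ⇔-id _
    ⊩-tail i ⊤' = ⇔-id _
    ⊩-tail i (¬' χ) = ¬-cong-⇔ (⊩-tail i χ)
    ⊩-tail i (a ∧' b) = ⊩-tail i a ×-⇔ ⊩-tail i b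
    ⊩-tail i (a ∨' b) = ⊩-tail i a ⊎-⇔ ⊩-tail i b
    ⊩-tail i (a ⇒ b) = →-cong-⇔ (⊩-tail i a) (⊩-tail i b)
    ⊩-tail i ([ m ] ψ) = mk⇔
      (λ H → Small.⊩□-intro ψ λ v r → Equivalence.to (⊩-tail v ψ) (Big.⊩□-elim ψ H (suc v) r))
      (λ H → Big.⊩□-intro ψ λ where
        zero ()
        (suc v) r → Equivalence.from (⊩-tail v ψ) (Small.⊩□-elim ψ H v r))

    label-head-≤ : ∀ v → label (step k s w) zero v ℕ.≤ toℕ k
    label-head-≤ zero = z≤n
    label-head-≤ (suc zero) = ℕ.≤-refl
    label-head-≤ (suc (suc v)) = ℕ.m⊓n≤m _ _

    no-loop : ∀ {m} → ¬ Rel Big.chain m zero zero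
    no-loop {m} r = ℕ.<-irrefl refl (proj₁ (Big.chain-Rel⁻ {m} {zero} {zero} r))

    head-lower⁻ : ∀ {m v} → m Fin.< k → Rel Big.chain m zero (suc v) → Rel Small.chain m zero v
    head-lower⁻ {m} {zero} m<k r = ⊥-elim (ℕ.<-irrefl (sym (proj₂ (Big.chain-Rel⁻ {m} {zero} {suc zero} r))) m<k)
    head-lower⁻ {m} {suc v} m<k r =
      Small.chain-Rel⁺ {m} {zero} {suc v} (s≤s z≤n) (⊓≡⇒≡ʳ (proj₂ (Big.chain-Rel⁻ {m} {zero} {suc (suc v)} r)) m<k)

    head-lower⁺ : ∀ {m v} → m Fin.< k → Rel Small.chain m zero v → Rel Big.chain m zero (suc v)
    head-lower⁺ {m} {zero} m<k r = ⊥-elim (ℕ.<-irrefl refl (proj₁ (Small.chain-Rel⁻ {m} {zero} {zero} r)))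
    head-lower⁺ {m} {suc v} m<k r =
      Big.chain-Rel⁺ {m} {zero} {suc (suc v)} (s≤s z≤n)
        (trans (cong (toℕ k ⊓_) (proj₂ (Small.chain-Rel⁻ {m} {zero} {suc v} r))) (ℕ.m≥n⇒m⊓n≡n (ℕ.<⇒≤ m<k)))

    head-higher : ∀ {m v} → k Fin.< m → ¬ Rel Big.chain m zero v
    head-higher {m} {v} k<m r = ℕ.<⇒≱ k<m (subst (ℕ._≤ toℕ k) (proj₂ (Big.chain-Rel⁻ {m} {zero} {v} r)) (label-head-≤ v))

    head-next : Rel Big.chain k zero (suc zero)
    head-next = Big.chain-Rel⁺ {k} {zero} {suc zero} (s≤s z≤n) refl

    head-same⁺ : ∀ {j v} → k Fin.≤ j → Rel Small.chain j zero v → Rel Big.chain k zero (suc v)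
    head-same⁺ {j} {zero} k≤j r = ⊥-elim (ℕ.<-irrefl refl (proj₁ (Small.chain-Rel⁻ {j} {zero} {zero} r)))
    head-same⁺ {j} {suc v} k≤j r =
      Big.chain-Rel⁺ {k} {zero} {suc (suc v)} (s≤s z≤n)
        (trans (cong (toℕ k ⊓_) (proj₂ (Small.chain-Rel⁻ {j} {zero} {suc v} r))) (ℕ.m≤n⇒m⊓n≡m k≤j))

    head-same⁻ : ∀ {v} → Rel Big.chain k zero (suc v) → v ≡ zero ⊎ ∃[ j ] (k Fin.≤ j × Rel Small.chain j zero v)
    head-same⁻ {zero} r = inj₁ refl
    head-same⁻ {suc v} r =
      inj₂ (fromℕ< bound , k≤j , Small.chain-Rel⁺ {fromℕ< bound} {zero} {suc v} (s≤s z≤n) (sym (Fin.toℕ-fromℕ< bound)))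
      where
      bound : label w zero (suc v) ℕ.< n
      bound = label-< w (s≤s z≤n)
      k≤j : k Fin.≤ fromℕ< bound
      k≤j = subst (toℕ k ℕ.≤_) (sym (Fin.toℕ-fromℕ< bound))
                  (ℕ.m⊓n≡m⇒m≤n (proj₂ (Big.chain-Rel⁻ {k} {zero} {suc (suc v)} r)))

    ⊩head-lower : ∀ {m} ψ → m Fin.< k → (zero Big.⊩ [ m ] ψ) ⇔ (zero Small.⊩ [ m ] ψ)
    ⊩head-lower {m} ψ m<k = mk⇔
      (λ H → Small.⊩□-intro ψ λ v r → Equivalence.to (⊩-tail v ψ) (Big.⊩□-elim ψ H (suc v) (head-lower⁺ m<k r)))
      (λ H → Big.⊩□-intro ψ λ where
        zero r → ⊥-elim (no-loop {m} r)
        (suc v) r → Equivalence.from (⊩-tail v ψ) (Small.⊩□-elim ψ H v (head-lower⁻ m<k r)))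

    ⊩head-higher : ∀ {m} ψ → k Fin.< m → zero Big.⊩ [ m ] ψ
    ⊩head-higher {m} ψ k<m = Big.⊩□-intro ψ λ v r → ⊥-elim (head-higher {m} {v} k<m r)

    ⊩head-same : ∀ ψ → (zero Big.⊩ [ k ] ψ) ⇔ (zero Small.⊩ ψ ∧' boxesFrom k ψ)
    ⊩head-same ψ = mk⇔
      (λ H → Equivalence.to (⊩-tail zero ψ) (Big.⊩□-elim ψ H (suc zero) head-next)
           , Small.⊩boxesFrom-intro k ψ λ j k≤j → Small.⊩□-intro ψ λ v r →
               Equivalence.to (⊩-tail v ψ) (Big.⊩□-elim ψ H (suc v) (head-same⁺ k≤j r)))
      (λ (ψ₀ , □ψ₀) → Big.⊩□-intro ψ λ where
        zero r → ⊥-elim (no-loop {k} r)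
        (suc v) r → Equivalence.from (⊩-tail v ψ) (later ψ₀ □ψ₀ (head-same⁻ r)))
      where
      later : ∀ {v} → zero Small.⊩ ψ → zero Small.⊩ boxesFrom k ψ →
              v ≡ zero ⊎ ∃[ j ] (k Fin.≤ j × Rel Small.chain j zero v) → v Small.⊩ ψ
      later ψ₀ _ (inj₁ refl) = ψ₀
      later {v} _ □ψ₀ (inj₂ (j , k≤j , r)) = Small.⊩□-elim ψ (Small.⊩boxesFrom-elim ψ □ψ₀ k≤j) v r

  forcesᵇ-cong : ∀ {A A′} (w : Word A) i χ (w′ : Word A′) i′ χ′ →
                 Frame._⊩_ w i χ ⇔ Frame._⊩_ w′ i′ χ′ → Frame.forcesᵇ w i χ ≡ Frame.forcesᵇ w′ i′ χ′
  forcesᵇ-cong w i χ w′ i′ χ′ = ⇔⇒does≡ (Frame.forces? w i χ) (Frame.forces? w′ i′ χ′)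

  mutual
    truth : ∀ {A} (w : Word A) i χ → Over P χ → Frame.forcesᵇ w i χ ≡ eval (atomAt w i) χ
    truth w i χ o = trans (Frame.forcesᵇ-beval w i χ)
      (beval-cong (λ {p} _ → does-≟-true (atomAt w i ⟦ var p ⟧)) (λ mψ∈ → truth-□ w i (∈-boxedIn⁺ mψ∈)) χ o)

    truth-□ : ∀ {A} (w : Word A) i {m ψ} → (m , ψ) ∈ Boxes → Frame.forcesᵇ w i ([ m ] ψ) ≡ atomAt w i ⟦ [ m ] ψ ⟧
    truth-□ (end final) zero {m} {ψ} mψ∈ =
      trans (Frame.⊩⇒forcesᵇ (end final) zero ([ m ] ψ) (Frame.⊩□-intro (end final) {zero} {m} ψ no-successor))
            (sym (All.lookup final mψ∈))
      where
      no-successor : ∀ v → Rel (Frame.chain (end final)) m zero v → Frame._⊩_ (end final) v ψ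
      no-successor zero r = ⊥-elim (ℕ.<-irrefl refl (proj₁ (Frame.chain-Rel⁻ (end final) {m} {zero} {zero} r)))
    truth-□ (step k s w) (suc i) {m} {ψ} mψ∈ =
      trans (forcesᵇ-cong (step k s w) (suc i) ([ m ] ψ) w i ([ m ] ψ) (Extension.⊩-tail k s w i ([ m ] ψ))) (truth-□ w i mψ∈)
    truth-□ (step k s w) zero {m} {ψ} mψ∈ with Fin.<-cmp m k | All.lookup s mψ∈
    ... | tri< m<k _ _ | A≡B =
      trans (forcesᵇ-cong (step k s w) zero ([ m ] ψ) w zero ([ m ] ψ) (Extension.⊩head-lower k s w ψ m<k))
            (trans (truth-□ w zero mψ∈) (sym A≡B))
    ... | tri> _ _ k<m | A≡true =
      trans (Frame.⊩⇒forcesᵇ (step k s w) zero ([ m ] ψ) (Extension.⊩head-higher k s w ψ k<m)) (sym A≡true)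
    ... | tri≈ _ refl _ | A≡α =
      trans (forcesᵇ-cong (step k s w) zero ([ k ] ψ) w zero (ψ ∧' boxesFrom k ψ) (Extension.⊩head-same k s w ψ))
            (trans (truth w zero (ψ ∧' boxesFrom k ψ) (Over-∧boxesFrom mψ∈)) (sym A≡α))

module _ {A : Set} {P Q : A → Set} (P? : Decidable P) (Q? : Decidable Q) (P⇒Q : ∀ {x} → P x → Q x) where

  length-filter-mono : ∀ xs → length (filter P? xs) ℕ.≤ length (filter Q? xs)
  length-filter-mono [] = z≤n
  length-filter-mono (x ∷ xs) with P? x | Q? x
  ... | yes _ | yes _ = s≤s (length-filter-mono xs)
  ... | yes p | no ¬q = contradiction (P⇒Q p) ¬q
  ... | no _ | yes _ = ℕ.m≤n⇒m≤1+n (length-filter-mono xs)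
  ... | no _ | no _ = length-filter-mono xs

  length-filter-strict : ∀ {xs y} → y ∈ xs → Q y → ¬ P y → length (filter P? xs) ℕ.< length (filter Q? xs)
  length-filter-strict {y ∷ xs} (here refl) q ¬p with P? y | Q? y
  ... | yes p | _ = contradiction p ¬p
  ... | no _ | yes _ = s≤s (length-filter-mono xs)
  ... | no _ | no ¬q = contradiction q ¬q
  length-filter-strict {x ∷ xs} (there y∈) q ¬p with P? x | Q? x
  ... | yes _ | yes _ = s≤s (length-filter-strict y∈ q ¬p)
  ... | yes p | no ¬q = contradiction (P⇒Q p) ¬q
  ... | no _ | yes _ = ℕ.m≤n⇒m≤1+n (length-filter-strict y∈ q ¬p)
  ... | no _ | no _ = length-filter-strict y∈ q ¬p

-- An increasing sequence of decidable predicates stabilises on any finite list: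
-- until it does, the number of elements satisfying it strictly increases.
stabilises : ∀ {A : Set} (Q : ℕ → A → Set) (Q? : ∀ t → Decidable (Q t)) → (∀ t {x} → Q t x → Q (suc t) x) →
             (xs : List A) → ∃[ t ] (∀ {x} → x ∈ xs → Q (suc t) x → Q t x)
stabilises {A} Q Q? Q-suc xs = search (length xs) 0 (ℕ.m≤m+n (length xs) (count 0))
  where
  count : ℕ → ℕ
  count t = length (filter (Q? t) xs)

  Stable : ℕ → Set
  Stable t = ∀ {x} → x ∈ xs → Q (suc t) x → Q t x

  progress : ∀ t → Stable t ⊎ count t ℕ.< count (suc t)
  progress t with All.all? (λ x → Q? (suc t) x →-dec Q? t x) xs
  ... | yes stable = inj₁ (All.lookup stable)
  ... | no unstable with find (¬All⇒Any¬ (λ x → Q? (suc t) x →-dec Q? t x) xs unstable)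
  ... | x , x∈ , ¬[Q′⇒Q] = inj₂ (length-filter-strict (Q? t) (Q? (suc t)) (Q-suc t) x∈ Q′x ¬Qx)
    where
    Q′x : Q (suc t) x
    Q′x = decidable-stable (Q? (suc t) x) λ ¬Q′x → ¬[Q′⇒Q] λ Q′x → contradiction Q′x ¬Q′x
    ¬Qx : ¬ Q t x
    ¬Qx Qx = ¬[Q′⇒Q] λ _ → Qx

  search : ∀ fuel t → length xs ℕ.≤ fuel + count t → ∃[ t ] Stable t
  search fuel t bound with progress t
  ... | inj₁ stable = t , stable
  search zero t bound | inj₂ grows =
    contradiction (ℕ.<-≤-trans grows (ℕ.≤-trans (length-filter (Q? (suc t)) xs) bound)) (ℕ.<-irrefl refl)
  search (suc fuel) t bound | inj₂ grows =
    search fuel (suc t)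
      (ℕ.≤-trans bound (subst (ℕ._≤ fuel + count (suc t)) (ℕ.+-suc fuel (count t)) (ℕ.+-monoʳ-≤ fuel grows)))

module Completeness {n : ℕ} (φ : Fm n) where
  P : List (Fm n)
  P = closure φ

  open Atoms P
  open Steps P (Closed-closure φ)
  open Words P (Closed-closure φ)

  Reaches : ℕ → Atom → Set
  Reaches zero A = Final A
  Reaches (suc t) A = Reaches t A ⊎ ∃[ k ] Any (λ B → Step k A B × Reaches t B) atoms

  reaches? : ∀ t A → Dec (Reaches t A)
  reaches? zero A = final? A
  reaches? (suc t) A = reaches? t A ⊎-dec Fin.any? λ k → Any.any? (λ B → step? k A B ×-dec reaches? t B) atoms

  final-reaches : ∀ t {A} → Final A → Reaches t A
  final-reaches zero final = final
  final-reaches (suc t) final = inj₁ (final-reaches t final)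

  word : ∀ t {A} → Reaches t A → Word A
  word zero final = end final
  word (suc t) (inj₁ r) = word t r
  word (suc t) (inj₂ (k , succ)) with find succ
  ... | B , _ , s , r = step k s (word t r)

  horizon : ∃[ t ] (∀ {A} → A ∈ atoms → Reaches (suc t) A → Reaches t A)
  horizon = stabilises Reaches reaches? (λ t → inj₁) atoms

  t* : ℕ
  t* = proj₁ horizon

  stuck : List Atom
  stuck = filter (λ A → ¬? (reaches? t* A)) atoms

  θ : Fm n
  θ = ⋁ (map char stuck)

  char⇒θ : ∀ A → ¬ Reaches t* A → ⊢ char A ⇒ θ
  char⇒θ A ¬r = ⋁-intro _ (∈-map⁺ char (∈-filter⁺ (λ A → ¬? (reaches? t* A)) (∈-vecs A) ¬r))

  -- A stuck atom refutes a box, and through its largest refuted label k all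
  -- k-successors are stuck as well.
  stuck-◇ : ∀ A → ¬ Reaches t* A → ⊢ char A ⇒ diamondsFrom 0 θ
  stuck-◇ A ¬r with nonFinal-refutes A (¬r ∘ final-reaches t*)
  ... | k₀ , refuted₀ with maximal (λ k → refutes? k A) refuted₀
  ... | k , refuted , top =
    Successor.char⇒◇ k A refuted top θ successor-stuck ⨾ diamondsFrom-intro k z≤n
    where
    successor-stuck : ∀ B → Step k A B → ⊢ char B ⇒ θ
    successor-stuck B s = char⇒θ B λ r → ¬r (proj₂ horizon (∈-vecs A) (inj₂ (k , lose (∈-vecs B) (s , r))))

  ⊢¬θ : ⊢ ¬' θ
  ⊢¬θ = löb-◇ θ (⋁-elim _ each)
    where
    each : ∀ {c} → c ∈ map char stuck → ⊢ c ⇒ diamondsFrom 0 θ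
    each c∈ with ∈-map⁻ char c∈
    ... | A , A∈ , refl = stuck-◇ A (proj₂ (∈-filter⁻ (λ A → ¬? (reaches? t* A)) {xs = atoms} A∈))

  complete : ValidFinHL φ → ⊢ φ
  complete valid = mp (⋁-elim _ each) char-cover
    where
    each : ∀ {c} → c ∈ map char atoms → ⊢ c ⇒ φ
    each c∈ with ∈-map⁻ char c∈
    ... | A , _ , refl with reaches? t* A
    ... | no ¬r = char⇒θ A ¬r ⨾ mp (taut-instance (‵¬ x₀ ‵⇒ x₀ ‵⇒ x₁) (θ ∷ φ ∷ [])) ⊢¬θ
    ... | yes r = subst (λ x → ⊢ char A ⇒ lit φ x) φ-true (char-decides A φ (Over-closure φ))
      where
      w : Word A
      w = word t* r
      φ-true : eval A φ ≡ true
      φ-true = trans (sym (truth w zero φ (Over-closure φ)))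
                     (Frame.⊩⇒forcesᵇ w zero φ (valid (size w) (Frame.chain w) (Frame.chain-isJn w)
                                                       (Frame.chain-hereditarilyLinear w) (Frame.valuation w) zero))

theorem3p10 : (n : ℕ) (φ : Fm n) → (JnLin⊢ φ → ValidFinHL φ) × (ValidFinHL φ → JnLin⊢ φ)
theorem3p10 n φ = (λ ⊢φ N R isJn hl V → Soundness.sound R isJn hl V ⊢φ) , Completeness.complete φ
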